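{- For every positive integer $n$, $$\sum_{\ell(\lambda)\le n}\binom{n}{m_0(\lambda),m_1(\lambda),\dots}\prod_{i=1}^n q_i^{\lambda_i}=\frac{\sum_{\pi\in S_n}\prod_{i=1}^n q_i^{d_i(\pi)}}{\prod_{i=1}^n(1-q_1\cdots q_i)}$$ in $\mathbf{Z}[[q_1,\dots,q_n]]$, where the sum on the left is over all partitions $\lambda=(\lambda_1,\dots,\lambda_n)$ with at most $n$ nonzero parts.
   Context: For a partition $\lambda=(\lambda_1\ge\dots\ge\lambda_n\ge0)$, $m_j(\lambda)=|\{1\le i\le n:\lambda_i=j\}|$ for $j\ge0$, and the coefficient is the multinomial coefficient. For $\pi\in S_n$, ${\it Des}(\pi)=\{i\in[n-1]:\pi(i)>\pi(i+1)\}$ and $d_i(\pi)=|\{j\in{\it Des}(\pi):j\ge i\}|$. -}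

module Defs where

open import Data.Nat as ℕ using (ℕ; zero; suc; NonZero; _<ᵇ_; _≤ᵇ_; _!)
open import Data.Nat.Properties using (m*n≢0; _!≢0)
open import Data.Nat.DivMod using (_/_)
open import Data.Nat.ListAction renaming (sum to sumℕ)
open import Data.Integer as ℤ using (ℤ; +_)
open import Data.Bool using (Bool; true; false; _∧_; if_then_else_)
open import Data.List as List using (List; []; _∷_; length; filter; upTo; concatMap)
import Data.List.Properties as LP
open import Data.Vec as Vec using (Vec; []; _∷_; toList; zipWith; replicate)
import Data.Vec.Properties as VP
open import Relation.Nullary using (does)
open import Relation.Binary.PropositionalEquality using (_≡_)

-- Formal power series in Z[[q_1,...,q_n]]:
-- a series is its coefficient function on exponent vectors
-- (e_1,...,e_n) ∈ ℕ^n, the coefficient of q_1^{e_1} ... q_n^{e_n}.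

FPS : ℕ → Set
FPS n = Vec ℕ n → ℤ

_≈_ : ∀ {n} → FPS n → FPS n → Set
f ≈ g = ∀ e → f e ≡ g e

sumℤ : List ℤ → ℤ
sumℤ = List.foldr ℤ._+_ (+ 0)

below : ∀ {n} → Vec ℕ n → List (Vec ℕ n)
below []      = [] ∷ []
below (x ∷ e) = concatMap (λ k → List.map (k ∷_) (below e)) (upTo (suc x))

_*ₛ_ : ∀ {n} → FPS n → FPS n → FPS n
(f *ₛ g) e = sumℤ (List.map (λ a → f a ℤ.* g (zipWith ℕ._∸_ e a)) (below e))

_-ₛ_ : ∀ {n} → FPS n → FPS n → FPS n
(f -ₛ g) e = f e ℤ.- g e

mono : ∀ {n} → Vec ℕ n → FPS n
mono v e = if does (VP.≡-dec ℕ._≟_ v e) then + 1 else + 0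

oneₛ : ∀ {n} → FPS n
oneₛ = mono (replicate _ 0)

prodₛ : ∀ {n} → List (FPS n) → FPS n
prodₛ = List.foldr _*ₛ_ oneₛ

prefixOnes : (n i : ℕ) → Vec ℕ n
prefixOnes zero    i       = []
prefixOnes (suc n) zero    = 0 ∷ prefixOnes n zero
prefixOnes (suc n) (suc i) = 1 ∷ prefixOnes n i

denominator : (n : ℕ) → FPS n
denominator n = prodₛ (List.map (λ i → oneₛ -ₛ mono (prefixOnes n (suc i))) (upTo n))

weaklyDecreasing : List ℕ → Bool
weaklyDecreasing []            = true
weaklyDecreasing (x ∷ [])      = true
weaklyDecreasing (x ∷ y ∷ xs)  = (y ≤ᵇ x) ∧ weaklyDecreasing (y ∷ xs)

mult : ℕ → List ℕ → ℕ
mult j xs = length (filter (ℕ._≟ j) xs)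

prodFact : List ℕ → ℕ
prodFact []       = 1
prodFact (k ∷ ks) = k ! ℕ.* prodFact ks

prodFact≢0 : ∀ ks → NonZero (prodFact ks)
prodFact≢0 []       = _
prodFact≢0 (k ∷ ks) = m*n≢0 (k !) (prodFact ks) {{k !≢0}} {{prodFact≢0 ks}}

multinomial : List ℕ → ℕ
multinomial ms = ((sumℕ ms) ! / prodFact ms) {{prodFact≢0 ms}}

-- the list (m_0(λ), m_1(λ), ..., m_N(λ)) where N = λ_1 + ... + λ_n
-- bounds every part (all further m_j vanish and contribute 0! = 1)
multiplicities : List ℕ → List ℕ
multiplicities xs = List.map (λ j → mult j xs) (upTo (suc (sumℕ xs)))

lhs : (n : ℕ) → FPS n
lhs n e = if weaklyDecreasing (toList e)
            then + multinomial (multiplicities (toList e))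
            else + 0

-- A permutation π ∈ S_n is represented by its one-line word
-- (π(1), ..., π(n)), a list of length n with distinct entries in {0..n-1}
-- (values shifted by one; irrelevant for descents).

words : ℕ → ℕ → List (List ℕ)
words zero    m = [] ∷ []
words (suc k) m = concatMap (λ x → List.map (x ∷_) (words k m)) (upTo m)

distinct : List ℕ → Bool
distinct []       = true
distinct (x ∷ xs) = (length (filter (ℕ._≟ x) xs) ℕ.≡ᵇ 0) ∧ distinct xs

perms : ℕ → List (List ℕ)
perms n = List.filter (λ w → Data.Bool._≟_ (distinct w) true) (words n n)
  where import Data.Bool

descentInd : List ℕ → List ℕ
descentInd []           = []
descentInd (x ∷ [])     = []
descentInd (x ∷ y ∷ xs) = (if y <ᵇ x then 1 else 0) ∷ descentInd (y ∷ xs)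

suffixSums : List ℕ → List ℕ
suffixSums []       = []
suffixSums (a ∷ as) = sumℕ (a ∷ as) ∷ suffixSums as

-- (d_1(π), ..., d_n(π)),  d_i(π) = |{ j ∈ Des(π) : j ≥ i }|
dvec : List ℕ → List ℕ
dvec w = suffixSums (List.map (λ i → mult' i) (List.upTo (length w)))
  where
    -- indicator that position (i+1) is a descent (0 for i+1 = n)
    mult' : ℕ → ℕ
    mult' i = sumℕ (List.take 1 (List.drop i (descentInd w)))

numerator : (n : ℕ) → FPS n
numerator n e = + length (filter (λ w → LP.≡-dec ℕ._≟_ (dvec w) (toList e)) (perms n))

{-# OPTIONS --safe #-}

-- Let P = ∑ q^λ over all partitions λ₁ ≥ ⋯ ≥ λₙ ≥ 0. Multiplying the partitions with
-- λ₁ = ⋯ = λⱼ by 1 − q₁⋯qⱼ leaves those with λ₁ = ⋯ = λⱼ₊₁ (where λₙ₊₁ = 0), so the product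
-- telescopes to P ⋅ ∏ᵢ (1 − q₁⋯qᵢ) = 1, and it suffices to show numerator ⋅ P = lhs.
-- Since dᵢ(π) − dᵢ₊₁(π) = [i ∈ Des π], the exponent E − d(π) is a partition exactly when
-- Eᵢ > Eᵢ₊₁ at every descent i of π (a P-partition argument). Hence the coefficient of q^E in
-- numerator ⋅ P counts the permutations increasing on every block of equal parts of E. Inserting
-- the letters one at a time, the largest letter must end a block, which gives the recursion of
-- the multinomial coefficient n! / ∏ⱼ mⱼ(E)!.
module Submission where

open import Defs
open import Algebra.Core using (Op₂)
open import Algebra.Structures using (IsCommutativeSemiring)
open import Algebra.Bundles using (CommutativeSemiring)
open import Data.Bool as Bool using (Bool; true; false; if_then_else_; _∧_; T)
open import Data.Nat as ℕ using (ℕ; zero; suc; _≤_; _<_; _≡ᵇ_; _<ᵇ_; _≤ᵇ_; z≤n; s≤s)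
import Data.Nat.Properties as ℕP
open import Data.List.Properties using (map-++; map-∘; map-upTo)
open import Data.List as List using (List; []; _∷_; _++_; length; concatMap; filter; upTo; applyUpTo)
open import Data.List.Relation.Unary.All as All using (All; []; _∷_)
open import Data.List.Relation.Unary.All.Properties using (++⁺)
open import Data.Vec using (Vec; []; _∷_; zipWith)
open import Function using (_∘_; id)
open import Data.Empty using (⊥-elim)
open import Data.Bool.Properties using (∧-zeroʳ; ∧-identityʳ; T-∧; T-≡; ¬-not)
open import Data.Product using (_,_; proj₁; proj₂)
open import Function.Bundles using (Equivalence)
open import Relation.Nullary using (does; ¬_)
open import Relation.Unary using (Decidable)
open import Relation.Binary.PropositionalEquality
  using (_≡_; _≢_; refl; sym; trans; cong; cong₂; subst; module ≡-Reasoning)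

T-∧ˡ : ∀ {x y} → T (x ∧ y) → T x
T-∧ˡ = proj₁ ∘ Equivalence.to T-∧

T-∧ʳ : ∀ {x y} → T (x ∧ y) → T y
T-∧ʳ = proj₂ ∘ Equivalence.to T-∧

T⇒≡true : ∀ {x} → T x → x ≡ true
T⇒≡true = Equivalence.to T-≡

¬T⇒≡false : ∀ {x} → ¬ T x → x ≡ false
¬T⇒≡false ¬x = ¬-not (¬x ∘ Equivalence.from T-≡)

T-ext : ∀ {x y} → (T x → T y) → (T y → T x) → x ≡ y
T-ext {true}  {true}  _ _ = refl
T-ext {true}  {false} f _ = ⊥-elim (f _)
T-ext {false} {true}  _ g = ⊥-elim (g _)
T-ext {false} {false} _ _ = refl

∧-swapˡ : ∀ x y z → x ∧ (y ∧ z) ≡ y ∧ (x ∧ z)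
∧-swapˡ true  y     z = refl
∧-swapˡ false true  z = refl
∧-swapˡ false false z = refl

≡ᵇ-refl : ∀ x → (x ≡ᵇ x) ≡ true
≡ᵇ-refl zero    = refl
≡ᵇ-refl (suc x) = ≡ᵇ-refl x

≢⇒≡ᵇ-false : ∀ x y → x ≢ y → (x ≡ᵇ y) ≡ false
≢⇒≡ᵇ-false zero    zero    x≢y = ⊥-elim (x≢y refl)
≢⇒≡ᵇ-false zero    (suc y) x≢y = refl
≢⇒≡ᵇ-false (suc x) zero    x≢y = refl
≢⇒≡ᵇ-false (suc x) (suc y) x≢y = ≢⇒≡ᵇ-false x y (x≢y ∘ cong suc)

<ᵇ-suc : ∀ m n → (m <ᵇ suc n) ≡ (m ≤ᵇ n)
<ᵇ-suc zero    n = refl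
<ᵇ-suc (suc m) n = refl

m<n⇒m+[n∸[1+m]]≡n∸1 : ∀ {m n} → m < n → m ℕ.+ (n ℕ.∸ suc m) ≡ n ℕ.∸ 1
m<n⇒m+[n∸[1+m]]≡n∸1 (s≤s m≤n) = ℕP.m+[n∸m]≡n m≤n

m<n⇒n≡1+[n∸1] : ∀ {m n} → m < n → n ≡ suc (n ℕ.∸ 1)
m<n⇒n≡1+[n∸1] (s≤s _) = refl

m<n⇒m≤n∸1 : ∀ {m n} → m < n → m ≤ n ℕ.∸ 1
m<n⇒m≤n∸1 (s≤s m≤n) = m≤n

insertAt : ℕ → ℕ → List ℕ → List ℕ
insertAt zero    m w       = m ∷ w
insertAt (suc p) m []      = m ∷ []
insertAt (suc p) m (x ∷ w) = x ∷ insertAt p m w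

insertAt-++ : ∀ m u v → insertAt (length u) m (u ++ v) ≡ u ++ m ∷ v
insertAt-++ m []      v = refl
insertAt-++ m (x ∷ u) v = cong (x ∷_) (insertAt-++ m u v)

mult-absent : ∀ {m} w → All (_< m) w → mult m w ≡ 0
mult-absent []      []          = refl
mult-absent {m} (y ∷ w) (y<m ∷ w<m) rewrite ≢⇒≡ᵇ-false y m (ℕP.<⇒≢ y<m) = mult-absent w w<m

mult-insertAt : ∀ x m p w → m ≢ x → mult x (insertAt p m w) ≡ mult x w
mult-insertAt x m zero    w       m≢x rewrite ≢⇒≡ᵇ-false m x m≢x = refl
mult-insertAt x m (suc p) []      m≢x rewrite ≢⇒≡ᵇ-false m x m≢x = refl
mult-insertAt x m (suc p) (y ∷ w) m≢x with y ≡ᵇ x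
... | true  = cong suc (mult-insertAt x m p w m≢x)
... | false = mult-insertAt x m p w m≢x

distinct-insertAt : ∀ m p w → All (_< m) w → distinct (insertAt p m w) ≡ distinct w
distinct-insertAt m zero    w       w<m rewrite mult-absent w w<m = refl
distinct-insertAt m (suc p) []      []  = refl
distinct-insertAt m (suc p) (y ∷ w) (y<m ∷ w<m)
  rewrite mult-insertAt y m p w (ℕP.>⇒≢ y<m) | distinct-insertAt m p w w<m = refl

distinct-++ʳ : ∀ u v → distinct v ≡ false → distinct (u ++ v) ≡ false
distinct-++ʳ []      v eq = eq
distinct-++ʳ (x ∷ u) v eq rewrite distinct-++ʳ u v eq = ∧-zeroʳ _

distinct-twice : ∀ m u u′ v → distinct (u ++ m ∷ u′ ++ m ∷ v) ≡ false
distinct-twice m u u′ v = distinct-++ʳ u (m ∷ u′ ++ m ∷ v) (cong (_∧ distinct (u′ ++ m ∷ v)) (occurs u′))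
  where
  occurs : ∀ u′ → (mult m (u′ ++ m ∷ v) ≡ᵇ 0) ≡ false
  occurs []       rewrite ≡ᵇ-refl m = refl
  occurs (y ∷ u′) with y ≡ᵇ m
  ... | true  = refl
  ... | false = occurs u′

module FiniteSums {A : Set} {add mul : Op₂ A} {0# 1# : A}
                  (isCS : IsCommutativeSemiring _≡_ add mul 0# 1#) where

  private
    infixl 6 _+_
    infixl 7 _*_
    _+_ _*_ : Op₂ A
    _+_ = add
    _*_ = mul

  open IsCommutativeSemiring isCS
    hiding (refl; sym; trans)
  private
    semiring : CommutativeSemiring _ _
    semiring = record { isCommutativeSemiring = isCS }
  open import Algebra.Properties.CommutativeSemigroup (CommutativeSemiring.+-commutativeSemigroup semiring)
    using (interchange; xy∙z≈x∙zy)

  [_] : Bool → A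
  [ b ] = if b then 1# else 0#

  if-∧ : ∀ b c (x : A) → (if b ∧ c then x else 0#) ≡ (if b then (if c then x else 0#) else 0#)
  if-∧ true  c x = refl
  if-∧ false c x = refl

  *-if : ∀ b (x y : A) → x * (if b then y else 0#) ≡ (if b then x * y else 0#)
  *-if true  x y = refl
  *-if false x y = zeroʳ x

  ∑< : ℕ → (ℕ → A) → A
  ∑< zero    f = 0#
  ∑< (suc n) f = f 0 + ∑< n (f ∘ suc)

  syntax ∑< n (λ k → e) = ∑[ k < n ] e

  ∑-cong< : ∀ n {f g : ℕ → A} → (∀ k → k < n → f k ≡ g k) → ∑< n f ≡ ∑< n g
  ∑-cong< zero    eq = refl
  ∑-cong< (suc n) eq = cong₂ _+_ (eq 0 (s≤s z≤n)) (∑-cong< n (λ k k<n → eq (suc k) (s≤s k<n)))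

  ∑-cong : ∀ n {f g : ℕ → A} → (∀ k → f k ≡ g k) → ∑< n f ≡ ∑< n g
  ∑-cong n eq = ∑-cong< n (λ k _ → eq k)

  ∑-zero : ∀ n → ∑[ k < n ] 0# ≡ 0#
  ∑-zero zero    = refl
  ∑-zero (suc n) = trans (cong (0# +_) (∑-zero n)) (+-identityˡ 0#)

  ∑-distrib-+ : ∀ n (f g : ℕ → A) → ∑[ k < n ] (f k + g k) ≡ ∑< n f + ∑< n g
  ∑-distrib-+ zero    f g = sym (+-identityˡ 0#)
  ∑-distrib-+ (suc n) f g = trans (cong ((f 0 + g 0) +_) (∑-distrib-+ n (f ∘ suc) (g ∘ suc)))
                                  (interchange (f 0) (g 0) _ _)

  *-distribˡ-∑ : ∀ n c (f : ℕ → A) → c * ∑< n f ≡ ∑[ k < n ] (c * f k)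
  *-distribˡ-∑ zero    c f = zeroʳ c
  *-distribˡ-∑ (suc n) c f = trans (distribˡ c (f 0) _) (cong (c * f 0 +_) (*-distribˡ-∑ n c (f ∘ suc)))

  *-distribʳ-∑ : ∀ n c (f : ℕ → A) → ∑< n f * c ≡ ∑[ k < n ] (f k * c)
  *-distribʳ-∑ zero    c f = zeroˡ c
  *-distribʳ-∑ (suc n) c f = trans (distribʳ c (f 0) _) (cong (f 0 * c +_) (*-distribʳ-∑ n c (f ∘ suc)))

  ∑-comm : ∀ m n (f : ℕ → ℕ → A) → ∑[ i < m ] ∑[ j < n ] f i j ≡ ∑[ j < n ] ∑[ i < m ] f i j
  ∑-comm zero    n f = sym (∑-zero n)
  ∑-comm (suc m) n f = trans (cong (∑< n (f 0) +_) (∑-comm m n (f ∘ suc)))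
                             (sym (∑-distrib-+ n (f 0) (λ j → ∑[ i < m ] f (suc i) j)))

  ∑-init-last : ∀ n (f : ℕ → A) → ∑< (suc n) f ≡ ∑< n f + f n
  ∑-init-last zero    f = trans (+-identityʳ (f 0)) (sym (+-identityˡ (f 0)))
  ∑-init-last (suc n) f = trans (cong (f 0 +_) (∑-init-last n (f ∘ suc))) (sym (+-assoc (f 0) _ _))

  ∑-δ : ∀ n y (f : ℕ → A) → ∑[ k < n ] (if y ≡ᵇ k then f k else 0#) ≡ (if y <ᵇ n then f y else 0#)
  ∑-δ zero    y       f = refl
  ∑-δ (suc n) zero    f = trans (cong (f 0 +_) (∑-zero n)) (+-identityʳ (f 0))
  ∑-δ (suc n) (suc y) f = trans (+-identityˡ _) (∑-δ n y (f ∘ suc))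

  ∑-δ-reversed : ∀ x y (f : ℕ → A) →
    ∑[ k < suc x ] (if y ≡ᵇ x ℕ.∸ k then f k else 0#) ≡ (if y ≤ᵇ x then f (x ℕ.∸ y) else 0#)
  ∑-δ-reversed zero    zero    f = +-identityʳ (f 0)
  ∑-δ-reversed zero    (suc y) f = +-identityʳ 0#
  ∑-δ-reversed (suc x) y f =
    trans (∑-init-last (suc x) g)
          (trans (cong₂ _+_ (∑-cong< (suc x) peel) (cong (λ m → if y ≡ᵇ m then f (suc x) else 0#) (ℕP.n∸n≡0 x)))
                 (last y))
    where
    g : ℕ → A
    g k = if y ≡ᵇ suc x ℕ.∸ k then f k else 0#
    peel : ∀ k → k < suc x → g k ≡ (if y ≡ᵇ suc (x ℕ.∸ k) then f k else 0#)
    peel k k≤x = cong (λ m → if y ≡ᵇ m then f k else 0#) (ℕP.+-∸-assoc 1 (ℕP.≤-pred k≤x))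
    last : ∀ y → ∑[ k < suc x ] (if y ≡ᵇ suc (x ℕ.∸ k) then f k else 0#) + (if y ≡ᵇ 0 then f (suc x) else 0#)
               ≡ (if y ≤ᵇ suc x then f (suc x ℕ.∸ y) else 0#)
    last zero    = trans (cong (_+ f (suc x)) (∑-zero (suc x))) (+-identityˡ (f (suc x)))
    last (suc y) = begin
        ∑[ k < suc x ] (if y ≡ᵇ x ℕ.∸ k then f k else 0#) + 0#
      ≡⟨ trans (+-identityʳ _) (∑-δ-reversed x y f) ⟩
        (if y ≤ᵇ x then f (x ℕ.∸ y) else 0#)
      ≡⟨ cong (λ b → if b then f (x ℕ.∸ y) else 0#) (sym (<ᵇ-suc y x)) ⟩
        (if y <ᵇ suc x then f (x ℕ.∸ y) else 0#)
      ∎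
      where open ≡-Reasoning

  ∑-triangle : ∀ x (f : ℕ → ℕ → A) →
    ∑[ k < suc x ] ∑[ j < suc k ] f j k ≡ ∑[ j < suc x ] ∑[ i < suc (x ℕ.∸ j) ] f j (j ℕ.+ i)
  ∑-triangle zero    f = refl
  ∑-triangle (suc x) f = begin
      (f 0 0 + 0#) + ∑[ k < suc x ] (f 0 (suc k) + ∑[ j < suc k ] f (suc j) (suc k))
    ≡⟨ cong ((f 0 0 + 0#) +_) (∑-distrib-+ (suc x) (λ k → f 0 (suc k)) (λ k → ∑[ j < suc k ] f (suc j) (suc k))) ⟩
      (f 0 0 + 0#) + (row + ∑[ k < suc x ] ∑[ j < suc k ] f (suc j) (suc k))
    ≡⟨ cong (λ s → (f 0 0 + 0#) + (row + s)) (∑-triangle x (λ j k → f (suc j) (suc k))) ⟩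
      (f 0 0 + 0#) + (row + rest)
    ≡⟨ trans (cong (_+ (row + rest)) (+-identityʳ (f 0 0))) (sym (+-assoc (f 0 0) row rest)) ⟩
      (f 0 0 + row) + rest
    ∎
    where
    open ≡-Reasoning
    row  = ∑[ k < suc x ] f 0 (suc k)
    rest = ∑[ j < suc x ] ∑[ i < suc (x ℕ.∸ j) ] f (suc j) (suc (j ℕ.+ i))

  sumₗ : List A → A
  sumₗ = List.foldr _+_ 0#

  sum-++ : ∀ xs ys → sumₗ (xs ++ ys) ≡ sumₗ xs + sumₗ ys
  sum-++ []       ys = sym (+-identityˡ _)
  sum-++ (x ∷ xs) ys = trans (cong (x +_) (sum-++ xs ys)) (sym (+-assoc x _ _))

  module _ {B : Set} where

    sum-map-cong : ∀ {f g : B → A} → (∀ x → f x ≡ g x) → ∀ xs → sumₗ (List.map f xs) ≡ sumₗ (List.map g xs)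
    sum-map-cong eq []       = refl
    sum-map-cong eq (x ∷ xs) = cong₂ _+_ (eq x) (sum-map-cong eq xs)

    sum-concatMap : ∀ {C : Set} (f : C → A) (g : B → List C) xs →
      sumₗ (List.map f (concatMap g xs)) ≡ sumₗ (List.map (λ x → sumₗ (List.map f (g x))) xs)
    sum-concatMap f g []       = refl
    sum-concatMap f g (x ∷ xs) = trans (trans (cong sumₗ (map-++ f (g x) _)) (sum-++ (List.map f (g x)) _))
                                       (cong (_ +_) (sum-concatMap f g xs))

    *-distribʳ-sum : ∀ c (f : B → A) xs → sumₗ (List.map f xs) * c ≡ sumₗ (List.map (λ x → f x * c) xs)
    *-distribʳ-sum c f []       = zeroˡ c
    *-distribʳ-sum c f (x ∷ xs) = trans (distribʳ c (f x) _) (cong (f x * c +_) (*-distribʳ-sum c f xs))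

    sum-filter : ∀ {P : B → Set} (P? : Decidable P) (f : B → A) xs →
      sumₗ (List.map f (filter P? xs)) ≡ sumₗ (List.map (λ x → if does (P? x) then f x else 0#) xs)
    sum-filter P? f [] = refl
    sum-filter P? f (x ∷ xs) with does (P? x)
    ... | true  = cong (f x +_) (sum-filter P? f xs)
    ... | false = trans (sum-filter P? f xs) (sym (+-identityˡ _))

  sum-applyUpTo : ∀ (f : ℕ → A) (g : ℕ → ℕ) n → sumₗ (List.map f (applyUpTo g n)) ≡ ∑< n (f ∘ g)
  sum-applyUpTo f g zero    = refl
  sum-applyUpTo f g (suc n) = cong (f (g 0) +_) (sum-applyUpTo f (g ∘ suc) n)

  sum-upTo : ∀ (f : ℕ → A) n → sumₗ (List.map f (upTo n)) ≡ ∑< n f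
  sum-upTo f = sum-applyUpTo f id

  sum-concatMap-upTo : ∀ {C D : Set} (f : D → A) (c : ℕ → C → D) ys m →
    sumₗ (List.map f (concatMap (λ x → List.map (c x) ys) (upTo m))) ≡ ∑[ x < m ] sumₗ (List.map (f ∘ c x) ys)
  sum-concatMap-upTo f c ys m = begin
      sumₗ (List.map f (concatMap (λ x → List.map (c x) ys) (upTo m)))
    ≡⟨ sum-concatMap f (λ x → List.map (c x) ys) (upTo m) ⟩
      sumₗ (List.map (λ x → sumₗ (List.map f (List.map (c x) ys))) (upTo m))
    ≡⟨ sum-map-cong (λ x → cong sumₗ (sym (map-∘ ys))) (upTo m) ⟩
      sumₗ (List.map (λ x → sumₗ (List.map (f ∘ c x) ys)) (upTo m))
    ≡⟨ sum-upTo (λ x → sumₗ (List.map (f ∘ c x) ys)) m ⟩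
      ∑[ x < m ] sumₗ (List.map (f ∘ c x) ys)
    ∎
    where open ≡-Reasoning

  ∑≤ : ∀ {n} → Vec ℕ n → (Vec ℕ n → A) → A
  ∑≤ []      f = f []
  ∑≤ (x ∷ e) f = ∑[ k < suc x ] ∑≤ e (λ a → f (k ∷ a))

  syntax ∑≤ e (λ a → t) = ∑[ a ≤ e ] t

  sum-below : ∀ {n} (e : Vec ℕ n) (f : Vec ℕ n → A) → sumₗ (List.map f (below e)) ≡ ∑≤ e f
  sum-below []      f = +-identityʳ (f [])
  sum-below (x ∷ e) f = trans (sum-concatMap-upTo f _∷_ (below e) (suc x))
                              (∑-cong (suc x) (λ k → sum-below e (λ a → f (k ∷ a))))

  ∑≤-cong : ∀ {n} (e : Vec ℕ n) {f g : Vec ℕ n → A} → (∀ a → f a ≡ g a) → ∑≤ e f ≡ ∑≤ e g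
  ∑≤-cong []      eq = eq []
  ∑≤-cong (x ∷ e) eq = ∑-cong (suc x) (λ k → ∑≤-cong e (λ a → eq (k ∷ a)))

  ∑≤-zero : ∀ {n} (e : Vec ℕ n) → ∑[ a ≤ e ] 0# ≡ 0#
  ∑≤-zero []      = refl
  ∑≤-zero (x ∷ e) = trans (∑-cong (suc x) (λ _ → ∑≤-zero e)) (∑-zero (suc x))

  ∑≤-distrib-+ : ∀ {n} (e : Vec ℕ n) (f g : Vec ℕ n → A) → ∑[ a ≤ e ] (f a + g a) ≡ ∑≤ e f + ∑≤ e g
  ∑≤-distrib-+ []      f g = refl
  ∑≤-distrib-+ (x ∷ e) f g = trans (∑-cong (suc x) (λ k → ∑≤-distrib-+ e (λ a → f (k ∷ a)) (λ a → g (k ∷ a))))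
                                   (∑-distrib-+ (suc x) (λ k → ∑≤ e (λ a → f (k ∷ a))) (λ k → ∑≤ e (λ a → g (k ∷ a))))

  *-distribˡ-∑≤ : ∀ {n} (e : Vec ℕ n) c (f : Vec ℕ n → A) → c * ∑≤ e f ≡ ∑[ a ≤ e ] (c * f a)
  *-distribˡ-∑≤ []      c f = refl
  *-distribˡ-∑≤ (x ∷ e) c f = trans (*-distribˡ-∑ (suc x) c (λ k → ∑≤ e (λ a → f (k ∷ a))))
                                    (∑-cong (suc x) (λ k → *-distribˡ-∑≤ e c (λ a → f (k ∷ a))))

  *-distribʳ-∑≤ : ∀ {n} (e : Vec ℕ n) c (f : Vec ℕ n → A) → ∑≤ e f * c ≡ ∑[ a ≤ e ] (f a * c)
  *-distribʳ-∑≤ []      c f = refl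
  *-distribʳ-∑≤ (x ∷ e) c f = trans (*-distribʳ-∑ (suc x) c (λ k → ∑≤ e (λ a → f (k ∷ a))))
                                    (∑-cong (suc x) (λ k → *-distribʳ-∑≤ e c (λ a → f (k ∷ a))))

  ∑-∑≤-comm : ∀ {n} m (e : Vec ℕ n) (f : ℕ → Vec ℕ n → A) → ∑[ k < m ] ∑≤ e (f k) ≡ ∑[ a ≤ e ] ∑[ k < m ] f k a
  ∑-∑≤-comm zero    e f = sym (∑≤-zero e)
  ∑-∑≤-comm (suc m) e f = trans (cong (∑≤ e (f 0) +_) (∑-∑≤-comm m e (f ∘ suc))) (sym (∑≤-distrib-+ e (f 0) _))

  sum-∑≤-comm : ∀ {B : Set} {n} (e : Vec ℕ n) (f : B → Vec ℕ n → A) xs →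
    ∑[ a ≤ e ] sumₗ (List.map (λ x → f x a) xs) ≡ sumₗ (List.map (λ x → ∑≤ e (f x)) xs)
  sum-∑≤-comm e f []       = ∑≤-zero e
  sum-∑≤-comm e f (x ∷ xs) = trans (∑≤-distrib-+ e (f x) _) (cong (∑≤ e (f x) +_) (sum-∑≤-comm e f xs))

  _+ᵥ_ _∸ᵥ_ : ∀ {n} → Vec ℕ n → Vec ℕ n → Vec ℕ n
  _+ᵥ_ = zipWith ℕ._+_
  _∸ᵥ_ = zipWith ℕ._∸_

  ∑≤-∑≤-reindex : ∀ {n} (e : Vec ℕ n) (f : Vec ℕ n → Vec ℕ n → A) →
    ∑[ c ≤ e ] ∑[ a ≤ c ] f a c ≡ ∑[ a ≤ e ] ∑[ b ≤ e ∸ᵥ a ] f a (a +ᵥ b)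
  ∑≤-∑≤-reindex []      f = refl
  ∑≤-∑≤-reindex (x ∷ e) f = begin
      ∑[ k < suc x ] ∑[ c ≤ e ] ∑[ j < suc k ] ∑[ a ≤ c ] f (j ∷ a) (k ∷ c)
    ≡⟨ ∑-cong (suc x) (λ k → sym (∑-∑≤-comm (suc k) e (λ j c → ∑[ a ≤ c ] f (j ∷ a) (k ∷ c)))) ⟩
      ∑[ k < suc x ] ∑[ j < suc k ] ∑[ c ≤ e ] ∑[ a ≤ c ] f (j ∷ a) (k ∷ c)
    ≡⟨ ∑-cong (suc x) (λ k → ∑-cong (suc k) (λ j → ∑≤-∑≤-reindex e (λ a c → f (j ∷ a) (k ∷ c)))) ⟩
      ∑[ k < suc x ] ∑[ j < suc k ] g j k
    ≡⟨ ∑-triangle x g ⟩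
      ∑[ j < suc x ] ∑[ i < suc (x ℕ.∸ j) ] g j (j ℕ.+ i)
    ≡⟨ ∑-cong (suc x) (λ j → ∑-∑≤-comm (suc (x ℕ.∸ j)) e (λ i a → ∑[ b ≤ e ∸ᵥ a ] f (j ∷ a) ((j ℕ.+ i) ∷ (a +ᵥ b)))) ⟩
      ∑[ a ≤ x ∷ e ] ∑[ b ≤ (x ∷ e) ∸ᵥ a ] f a (a +ᵥ b)
    ∎
    where
    open ≡-Reasoning
    g : ℕ → ℕ → A
    g j k = ∑[ a ≤ e ] ∑[ b ≤ e ∸ᵥ a ] f (j ∷ a) (k ∷ (a +ᵥ b))

  ∑≤-if : ∀ {n} (e : Vec ℕ n) b (f : Vec ℕ n → A) → ∑[ a ≤ e ] (if b then f a else 0#) ≡ (if b then ∑≤ e f else 0#)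
  ∑≤-if e true  f = refl
  ∑≤-if e false f = ∑≤-zero e

  ∑word : ℕ → ℕ → (List ℕ → A) → A
  ∑word zero    m f = f []
  ∑word (suc k) m f = ∑[ x < m ] ∑word k m (λ w → f (x ∷ w))

  sum-words : ∀ k m (f : List ℕ → A) → sumₗ (List.map f (words k m)) ≡ ∑word k m f
  sum-words zero    m f = +-identityʳ (f [])
  sum-words (suc k) m f = trans (sum-concatMap-upTo f _∷_ (words k m) m)
                                (∑-cong m (λ x → sum-words k m (λ w → f (x ∷ w))))

  ∑word-cong : ∀ k m {f g : List ℕ → A} → (∀ w → length w ≡ k → All (_< m) w → f w ≡ g w) →
    ∑word k m f ≡ ∑word k m g
  ∑word-cong zero    m eq = eq [] refl []
  ∑word-cong (suc k) m eq =
    ∑-cong< m (λ x x<m → ∑word-cong k m (λ w |w|≡k w<m → eq (x ∷ w) (cong suc |w|≡k) (x<m ∷ w<m)))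

  ∑word-zero : ∀ k m → ∑word k m (λ _ → 0#) ≡ 0#
  ∑word-zero zero    m = refl
  ∑word-zero (suc k) m = trans (∑-cong m (λ _ → ∑word-zero k m)) (∑-zero m)

  *-distribˡ-∑word : ∀ k m c (f : List ℕ → A) → c * ∑word k m f ≡ ∑word k m (λ w → c * f w)
  *-distribˡ-∑word zero    m c f = refl
  *-distribˡ-∑word (suc k) m c f =
    trans (*-distribˡ-∑ m c _) (∑-cong m (λ x → *-distribˡ-∑word k m c (λ w → f (x ∷ w))))

  ∑word-++ : ∀ p j m (f : List ℕ → A) → ∑word (p ℕ.+ j) m f ≡ ∑word p m (λ u → ∑word j m (λ v → f (u ++ v)))
  ∑word-++ zero    j m f = refl
  ∑word-++ (suc p) j m f = ∑-cong m (λ x → ∑word-++ p j m (λ w → f (x ∷ w)))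

  -- A word over {0, …, m} either avoids the letter m or has a first occurrence of it at some position p.
  ∑word-suc : ∀ k m (f : List ℕ → A) →
    ∑word k (suc m) f ≡
    ∑word k m f + ∑[ p < k ] ∑word p m (λ u → ∑word (k ℕ.∸ suc p) (suc m) (λ v → f (u ++ m ∷ v)))
  ∑word-suc zero    m f = sym (+-identityʳ (f []))
  ∑word-suc (suc k) m f = begin
      ∑[ x < suc m ] ∑word k (suc m) (λ w → f (x ∷ w))
    ≡⟨ ∑-init-last m _ ⟩
      ∑[ x < m ] ∑word k (suc m) (λ w → f (x ∷ w)) + firstM
    ≡⟨ cong (_+ firstM) (∑-cong m (λ x → ∑word-suc k m (λ w → f (x ∷ w)))) ⟩
      ∑[ x < m ] (∑word k m (λ w → f (x ∷ w)) + ∑[ p < k ] later x p) + firstM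
    ≡⟨ cong (_+ firstM) (∑-distrib-+ m _ _) ⟩
      (avoid + ∑[ x < m ] ∑[ p < k ] later x p) + firstM
    ≡⟨ cong (λ s → (avoid + s) + firstM) (∑-comm m k later) ⟩
      (avoid + ∑[ p < k ] ∑[ x < m ] later x p) + firstM
    ≡⟨ xy∙z≈x∙zy avoid _ firstM ⟩
      avoid + (firstM + ∑[ p < k ] ∑[ x < m ] later x p)
    ∎
    where
    open ≡-Reasoning
    avoid  = ∑word (suc k) m f
    firstM = ∑word k (suc m) (λ v → f (m ∷ v))
    later : ℕ → ℕ → A
    later x p = ∑word p m (λ u → ∑word (k ℕ.∸ suc p) (suc m) (λ v → f (x ∷ u ++ m ∷ v)))

  ∑injective : ℕ → ℕ → (List ℕ → A) → A
  ∑injective k m f = ∑word k m (λ w → if distinct w then f w else 0#)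

  -- An injective word over {0, …, m} either avoids m or arises by inserting m once into one over {0, …, m-1}.
  ∑injective-suc : ∀ k m (f : List ℕ → A) →
    ∑injective k (suc m) f ≡ ∑injective k m f + ∑[ p < k ] ∑injective (k ℕ.∸ 1) m (f ∘ insertAt p m)
  ∑injective-suc k m f = trans (∑word-suc k m g) (cong (∑injective k m f +_) (∑-cong< k insertion))
    where
    g : List ℕ → A
    g w = if distinct w then f w else 0#
    noSecondM : ∀ j u → ∑word j (suc m) (λ v → g (u ++ m ∷ v)) ≡ ∑word j m (λ v → g (u ++ m ∷ v))
    noSecondM j u = trans (∑word-suc j m (λ v → g (u ++ m ∷ v)))
                          (trans (cong (∑word j m (λ v → g (u ++ m ∷ v)) +_) later≡0) (+-identityʳ _))
      where
      twice : ∀ p u′ → ∑word (j ℕ.∸ suc p) (suc m) (λ v → g (u ++ m ∷ u′ ++ m ∷ v)) ≡ 0#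
      twice p u′ = trans (∑word-cong (j ℕ.∸ suc p) (suc m) (λ v _ _ →
                            cong (λ b → if b then f (u ++ m ∷ u′ ++ m ∷ v) else 0#) (distinct-twice m u u′ v)))
                         (∑word-zero (j ℕ.∸ suc p) (suc m))
      later≡0 : ∑[ p < j ] ∑word p m (λ u′ → ∑word (j ℕ.∸ suc p) (suc m) (λ v → g (u ++ m ∷ u′ ++ m ∷ v))) ≡ 0#
      later≡0 = trans (∑-cong j (λ p → trans (∑word-cong p m (λ u′ _ _ → twice p u′)) (∑word-zero p m))) (∑-zero j)
    reinsert : ∀ u v → All (_< m) u → All (_< m) v →
      g (u ++ m ∷ v) ≡ (if distinct (u ++ v) then f (insertAt (length u) m (u ++ v)) else 0#)
    reinsert u v u<m v<m
      rewrite sym (insertAt-++ m u v) | distinct-insertAt m (length u) (u ++ v) (++⁺ u<m v<m) = refl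
    insertion : ∀ p → p < k →
      ∑word p m (λ u → ∑word (k ℕ.∸ suc p) (suc m) (λ v → g (u ++ m ∷ v))) ≡ ∑injective (k ℕ.∸ 1) m (f ∘ insertAt p m)
    insertion p p<k = begin
        ∑word p m (λ u → ∑word (k ℕ.∸ suc p) (suc m) (λ v → g (u ++ m ∷ v)))
      ≡⟨ ∑word-cong p m (λ u |u|≡p u<m → trans (noSecondM (k ℕ.∸ suc p) u) (∑word-cong (k ℕ.∸ suc p) m (λ v _ v<m →
           trans (reinsert u v u<m v<m)
                 (cong (λ q → if distinct (u ++ v) then f (insertAt q m (u ++ v)) else 0#) |u|≡p)))) ⟩
        ∑word p m (λ u → ∑word (k ℕ.∸ suc p) m (λ v → h (u ++ v)))
      ≡⟨ ∑word-++ p (k ℕ.∸ suc p) m h ⟨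
        ∑word (p ℕ.+ (k ℕ.∸ suc p)) m h
      ≡⟨ cong (λ i → ∑word i m h) (m<n⇒m+[n∸[1+m]]≡n∸1 p<k) ⟩
        ∑word (k ℕ.∸ 1) m h
      ∎
      where
      open ≡-Reasoning
      h : List ℕ → A
      h w = if distinct w then f (insertAt p m w) else 0#

module PowerSeriesAlgebra where

  open import Data.Integer as ℤ using (ℤ; +_; _+_; _*_; _-_)
  import Data.Integer.Properties as ℤP
  open import Data.Vec using (replicate)
  open FiniteSums ℤP.+-*-isCommutativeSemiring public
  open import Algebra.Properties.Ring ℤP.+-*-ring using (x[y-z]≈xy-xz)

  coeff-*ₛ : ∀ {n} (f g : FPS n) e → (f *ₛ g) e ≡ ∑[ a ≤ e ] (f a * g (e ∸ᵥ a))
  coeff-*ₛ f g e = sum-below e (λ a → f a * g (e ∸ᵥ a))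

  *ₛ-congˡ : ∀ {n} {f g : FPS n} (h : FPS n) → f ≈ g → (f *ₛ h) ≈ (g *ₛ h)
  *ₛ-congˡ h f≈g e = sum-map-cong (λ a → cong (_* h _) (f≈g a)) (below e)

  *ₛ-congʳ : ∀ {n} (h : FPS n) {f g : FPS n} → f ≈ g → (h *ₛ f) ≈ (h *ₛ g)
  *ₛ-congʳ h f≈g e = sum-map-cong (λ a → cong (h a *_) (f≈g _)) (below e)

  +ᵥ-∸ᵥ : ∀ {n} (a b : Vec ℕ n) → (a +ᵥ b) ∸ᵥ a ≡ b
  +ᵥ-∸ᵥ []      []      = refl
  +ᵥ-∸ᵥ (x ∷ a) (y ∷ b) = cong₂ _∷_ (ℕP.m+n∸m≡n x y) (+ᵥ-∸ᵥ a b)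

  ∸ᵥ-+ᵥ : ∀ {n} (e a b : Vec ℕ n) → e ∸ᵥ (a +ᵥ b) ≡ (e ∸ᵥ a) ∸ᵥ b
  ∸ᵥ-+ᵥ []      []      []      = refl
  ∸ᵥ-+ᵥ (z ∷ e) (x ∷ a) (y ∷ b) = cong₂ _∷_ (sym (ℕP.∸-+-assoc z x y)) (∸ᵥ-+ᵥ e a b)

  *ₛ-assoc : ∀ {n} (f g h : FPS n) → ((f *ₛ g) *ₛ h) ≈ (f *ₛ (g *ₛ h))
  *ₛ-assoc f g h e = begin
      ((f *ₛ g) *ₛ h) e
    ≡⟨ coeff-*ₛ (f *ₛ g) h e ⟩
      ∑[ c ≤ e ] ((f *ₛ g) c * h (e ∸ᵥ c))
    ≡⟨ ∑≤-cong e (λ c → trans (cong (_* h (e ∸ᵥ c)) (coeff-*ₛ f g c)) (*-distribʳ-∑≤ c (h (e ∸ᵥ c)) _)) ⟩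
      ∑[ c ≤ e ] ∑[ a ≤ c ] (f a * g (c ∸ᵥ a) * h (e ∸ᵥ c))
    ≡⟨ ∑≤-∑≤-reindex e (λ a c → f a * g (c ∸ᵥ a) * h (e ∸ᵥ c)) ⟩
      ∑[ a ≤ e ] ∑[ b ≤ e ∸ᵥ a ] (f a * g ((a +ᵥ b) ∸ᵥ a) * h (e ∸ᵥ (a +ᵥ b)))
    ≡⟨ ∑≤-cong e (λ a → ∑≤-cong (e ∸ᵥ a) (λ b →
         trans (cong₂ (λ u w → f a * g u * h w) (+ᵥ-∸ᵥ a b) (∸ᵥ-+ᵥ e a b)) (ℤP.*-assoc (f a) _ _))) ⟩
      ∑[ a ≤ e ] ∑[ b ≤ e ∸ᵥ a ] (f a * (g b * h ((e ∸ᵥ a) ∸ᵥ b)))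
    ≡⟨ ∑≤-cong e (λ a → trans (sym (*-distribˡ-∑≤ (e ∸ᵥ a) (f a) _)) (cong (f a *_) (sym (coeff-*ₛ g h (e ∸ᵥ a))))) ⟩
      ∑[ a ≤ e ] (f a * (g *ₛ h) (e ∸ᵥ a))
    ≡⟨ coeff-*ₛ f (g *ₛ h) e ⟨
      (f *ₛ (g *ₛ h)) e
    ∎
    where open ≡-Reasoning

  ∑≤-distrib-- : ∀ {n} (e : Vec ℕ n) (f g : Vec ℕ n → ℤ) → ∑[ a ≤ e ] (f a - g a) ≡ ∑≤ e f - ∑≤ e g
  ∑≤-distrib-- e f g = begin
      ∑[ a ≤ e ] (f a - g a)
    ≡⟨ ∑≤-cong e (λ a → cong (_+_ (f a)) (sym (ℤP.-1*i≡-i (g a)))) ⟩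
      ∑[ a ≤ e ] (f a + ℤ.-1ℤ * g a)
    ≡⟨ ∑≤-distrib-+ e f (λ a → ℤ.-1ℤ * g a) ⟩
      ∑≤ e f + ∑[ a ≤ e ] (ℤ.-1ℤ * g a)
    ≡⟨ cong (_+_ (∑≤ e f)) (trans (sym (*-distribˡ-∑≤ e ℤ.-1ℤ g)) (ℤP.-1*i≡-i (∑≤ e g))) ⟩
      ∑≤ e f - ∑≤ e g
    ∎
    where open ≡-Reasoning

  *ₛ-distribˡ--ₛ : ∀ {n} (f g h : FPS n) → (f *ₛ (g -ₛ h)) ≈ ((f *ₛ g) -ₛ (f *ₛ h))
  *ₛ-distribˡ--ₛ f g h e = begin
      (f *ₛ (g -ₛ h)) e
    ≡⟨ coeff-*ₛ f (g -ₛ h) e ⟩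
      ∑[ a ≤ e ] (f a * (g (e ∸ᵥ a) - h (e ∸ᵥ a)))
    ≡⟨ ∑≤-cong e (λ a → x[y-z]≈xy-xz (f a) (g (e ∸ᵥ a)) (h (e ∸ᵥ a))) ⟩
      ∑[ a ≤ e ] (f a * g (e ∸ᵥ a) - f a * h (e ∸ᵥ a))
    ≡⟨ ∑≤-distrib-- e _ _ ⟩
      ∑[ a ≤ e ] (f a * g (e ∸ᵥ a)) - ∑[ a ≤ e ] (f a * h (e ∸ᵥ a))
    ≡⟨ cong₂ _-_ (coeff-*ₛ f g e) (coeff-*ₛ f h e) ⟨
      (f *ₛ g) e - (f *ₛ h) e
    ∎
    where open ≡-Reasoning

  _⊑ᵇ_ : ∀ {n} → Vec ℕ n → Vec ℕ n → Bool
  []      ⊑ᵇ []      = true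
  (y ∷ v) ⊑ᵇ (x ∷ e) = (y ≤ᵇ x) ∧ (v ⊑ᵇ e)

  mono-∷ : ∀ {n} y z (v u : Vec ℕ n) → mono (y ∷ v) (z ∷ u) ≡ (if y ≡ᵇ z then mono v u else + 0)
  mono-∷ y z v u with y ≡ᵇ z
  ... | true  = refl
  ... | false = refl

  ∑≤-*-mono : ∀ {n} (e v : Vec ℕ n) (f : Vec ℕ n → ℤ) →
    ∑[ a ≤ e ] (f a * mono v (e ∸ᵥ a)) ≡ (if v ⊑ᵇ e then f (e ∸ᵥ v) else + 0)
  ∑≤-*-mono []      []      f = ℤP.*-identityʳ (f [])
  ∑≤-*-mono (x ∷ e) (y ∷ v) f = begin
      ∑[ k < suc x ] ∑[ a ≤ e ] (f (k ∷ a) * mono (y ∷ v) ((x ℕ.∸ k) ∷ (e ∸ᵥ a)))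
    ≡⟨ ∑-cong (suc x) (λ k → trans (∑≤-cong e (λ a → trans (cong (f (k ∷ a) *_) (mono-∷ y (x ℕ.∸ k) v (e ∸ᵥ a)))
                                                           (*-if (y ≡ᵇ x ℕ.∸ k) (f (k ∷ a)) _)))
                                   (∑≤-if e (y ≡ᵇ x ℕ.∸ k) (λ a → f (k ∷ a) * mono v (e ∸ᵥ a)))) ⟩
      ∑[ k < suc x ] (if y ≡ᵇ x ℕ.∸ k then ∑[ a ≤ e ] (f (k ∷ a) * mono v (e ∸ᵥ a)) else + 0)
    ≡⟨ ∑-cong (suc x) (λ k → cong (λ z → if y ≡ᵇ x ℕ.∸ k then z else + 0) (∑≤-*-mono e v (λ a → f (k ∷ a)))) ⟩
      ∑[ k < suc x ] (if y ≡ᵇ x ℕ.∸ k then (if v ⊑ᵇ e then f (k ∷ (e ∸ᵥ v)) else + 0) else + 0)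
    ≡⟨ ∑-δ-reversed x y (λ k → if v ⊑ᵇ e then f (k ∷ (e ∸ᵥ v)) else + 0) ⟩
      (if y ≤ᵇ x then (if v ⊑ᵇ e then f ((x ℕ.∸ y) ∷ (e ∸ᵥ v)) else + 0) else + 0)
    ≡⟨ if-∧ (y ≤ᵇ x) (v ⊑ᵇ e) _ ⟨
      (if (y ∷ v) ⊑ᵇ (x ∷ e) then f ((x ∷ e) ∸ᵥ (y ∷ v)) else + 0)
    ∎
    where open ≡-Reasoning

  *ₛ-mono : ∀ {n} (f : FPS n) v e → (f *ₛ mono v) e ≡ (if v ⊑ᵇ e then f (e ∸ᵥ v) else + 0)
  *ₛ-mono f v e = trans (coeff-*ₛ f (mono v) e) (∑≤-*-mono e v f)

  0ᵥ⊑ᵇ : ∀ {n} (e : Vec ℕ n) → replicate n 0 ⊑ᵇ e ≡ true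
  0ᵥ⊑ᵇ []      = refl
  0ᵥ⊑ᵇ (x ∷ e) = 0ᵥ⊑ᵇ e

  ∸ᵥ-identityʳ : ∀ {n} (e : Vec ℕ n) → e ∸ᵥ replicate n 0 ≡ e
  ∸ᵥ-identityʳ []      = refl
  ∸ᵥ-identityʳ (x ∷ e) = cong (x ∷_) (∸ᵥ-identityʳ e)

  *ₛ-identityʳ : ∀ {n} (f : FPS n) → (f *ₛ oneₛ) ≈ f
  *ₛ-identityʳ {n} f e = begin
      (f *ₛ oneₛ) e
    ≡⟨ *ₛ-mono f (replicate n 0) e ⟩
      (if replicate n 0 ⊑ᵇ e then f (e ∸ᵥ replicate n 0) else + 0)
    ≡⟨ cong (λ b → if b then f (e ∸ᵥ replicate n 0) else + 0) (0ᵥ⊑ᵇ e) ⟩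
      f (e ∸ᵥ replicate n 0)
    ≡⟨ cong f (∸ᵥ-identityʳ e) ⟩
      f e
    ∎
    where open ≡-Reasoning

  *ₛ-[one-mono] : ∀ {n} (f : FPS n) v e →
    (f *ₛ (oneₛ -ₛ mono v)) e ≡ f e - (if v ⊑ᵇ e then f (e ∸ᵥ v) else + 0)
  *ₛ-[one-mono] f v e = trans (*ₛ-distribˡ--ₛ f oneₛ (mono v) e) (cong₂ _-_ (*ₛ-identityʳ f e) (*ₛ-mono f v e))

  telescope : ∀ {n} m (s t : ℕ → FPS n) → (∀ k → k < m → (s k *ₛ t k) ≈ s (suc k)) →
    (s 0 *ₛ prodₛ (applyUpTo t m)) ≈ s m
  telescope zero    s t step = *ₛ-identityʳ (s 0)
  telescope (suc m) s t step e = begin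
      (s 0 *ₛ (t 0 *ₛ rest)) e
    ≡⟨ *ₛ-assoc (s 0) (t 0) rest e ⟨
      ((s 0 *ₛ t 0) *ₛ rest) e
    ≡⟨ *ₛ-congˡ rest (step 0 (s≤s z≤n)) e ⟩
      (s 1 *ₛ rest) e
    ≡⟨ telescope m (s ∘ suc) (t ∘ suc) (λ k k<m → step (suc k) (s≤s k<m)) e ⟩
      s (suc m) e
    ∎
    where
    open ≡-Reasoning
    rest = prodₛ (applyUpTo (t ∘ suc) m)

module PartitionSeries where

  open import Data.Integer using (+_; _-_)
  open import Data.Vec using (toList; replicate)
  open PowerSeriesAlgebra

  -- plateau j λ: λ is a partition with λ₁ = ⋯ = λⱼ₊₁, where parts beyond the length of λ are 0
  plateau : ℕ → List ℕ → Bool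
  plateau zero    L           = weaklyDecreasing L
  plateau (suc j) []          = true
  plateau (suc j) (a ∷ [])    = a ≡ᵇ 0
  plateau (suc j) (a ∷ b ∷ L) = (a ≡ᵇ b) ∧ plateau j (b ∷ L)

  plateauₛ : ∀ {n} → ℕ → FPS n
  plateauₛ j e = [ plateau j (toList e) ]

  partitionsₛ : ∀ {n} → FPS n
  partitionsₛ = plateauₛ 0

  prefixOnes-zero : ∀ n → prefixOnes n 0 ≡ replicate n 0
  prefixOnes-zero zero    = refl
  prefixOnes-zero (suc n) = cong (0 ∷_) (prefixOnes-zero n)

  [≤ᵇsuc]-[≤ᵇ] : ∀ a b → [ b ≤ᵇ suc a ] - [ b ≤ᵇ a ] ≡ [ suc a ≡ᵇ b ]
  [≤ᵇsuc]-[≤ᵇ] a       zero          = refl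
  [≤ᵇsuc]-[≤ᵇ] zero    (suc zero)    = refl
  [≤ᵇsuc]-[≤ᵇ] zero    (suc (suc b)) = refl
  [≤ᵇsuc]-[≤ᵇ] (suc a) (suc b) rewrite <ᵇ-suc b (suc a) | <ᵇ-suc b a = [≤ᵇsuc]-[≤ᵇ] a b

  lowerFirst-[≤ᵇ∧] : ∀ a b W →
    [ (b ≤ᵇ a) ∧ W ] - (if 1 ≤ᵇ a then [ (b ≤ᵇ a ℕ.∸ 1) ∧ W ] else + 0) ≡ [ (a ≡ᵇ b) ∧ W ]
  lowerFirst-[≤ᵇ∧] a b false rewrite ∧-zeroʳ (b ≤ᵇ a) | ∧-zeroʳ (b ≤ᵇ a ℕ.∸ 1) | ∧-zeroʳ (a ≡ᵇ b) with 1 ≤ᵇ a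
  ... | true  = refl
  ... | false = refl
  lowerFirst-[≤ᵇ∧] zero    zero    true = refl
  lowerFirst-[≤ᵇ∧] zero    (suc b) true = refl
  lowerFirst-[≤ᵇ∧] (suc a) b       true
    rewrite ∧-identityʳ (b ≤ᵇ suc a) | ∧-identityʳ (b ≤ᵇ a) | ∧-identityʳ (suc a ≡ᵇ b) =
    [≤ᵇsuc]-[≤ᵇ] a b

  plateau-step-zero : ∀ a L →
    [ weaklyDecreasing (a ∷ L) ] - (if 1 ≤ᵇ a then [ weaklyDecreasing ((a ℕ.∸ 1) ∷ L) ] else + 0)
      ≡ [ plateau 1 (a ∷ L) ]
  plateau-step-zero zero    []      = refl
  plateau-step-zero (suc a) []      = refl
  plateau-step-zero a       (b ∷ L) = lowerFirst-[≤ᵇ∧] a b (weaklyDecreasing (b ∷ L))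

  plateau-step-suc : ∀ a b X Y Z c → [ X ] - (if (1 ≤ᵇ b) ∧ c then [ Y ] else + 0) ≡ [ Z ] →
    [ (a ≡ᵇ b) ∧ X ] - (if (1 ≤ᵇ a) ∧ ((1 ≤ᵇ b) ∧ c) then [ (a ℕ.∸ 1 ≡ᵇ b ℕ.∸ 1) ∧ Y ] else + 0) ≡ [ (a ≡ᵇ b) ∧ Z ]
  plateau-step-suc zero    zero    X Y Z c ih = ih
  plateau-step-suc (suc a) zero    X Y Z c ih = refl
  plateau-step-suc zero    (suc b) X Y Z c ih = refl
  plateau-step-suc (suc a) (suc b) X Y Z c ih with a ≡ᵇ b | c
  ... | true  | _     = ih
  ... | false | true  = refl
  ... | false | false = refl

  plateau-step : ∀ j {n} (e : Vec ℕ n) → suc j ≤ n →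
    plateauₛ j e - (if prefixOnes n (suc j) ⊑ᵇ e then plateauₛ j (e ∸ᵥ prefixOnes n (suc j)) else + 0)
      ≡ plateauₛ (suc j) e
  plateau-step zero {suc m} (a ∷ e) _
    rewrite prefixOnes-zero m | 0ᵥ⊑ᵇ e | ∸ᵥ-identityʳ e | ∧-identityʳ (1 ≤ᵇ a) = plateau-step-zero a (toList e)
  plateau-step (suc j) (a ∷ b ∷ e) (s≤s j<n) =
    plateau-step-suc a b _ _ _ _ (plateau-step j (b ∷ e) j<n)

  plateauₛ-full : ∀ n (e : Vec ℕ n) → plateauₛ n e ≡ oneₛ e
  plateauₛ-full zero          []                  = refl
  plateauₛ-full (suc zero)    (zero ∷ [])         = refl
  plateauₛ-full (suc zero)    (suc a ∷ [])        = refl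
  plateauₛ-full (suc (suc n)) (zero ∷ zero ∷ e)   = plateauₛ-full (suc n) (zero ∷ e)
  plateauₛ-full (suc (suc n)) (zero ∷ suc b ∷ e)  = refl
  plateauₛ-full (suc (suc n)) (suc a ∷ zero ∷ e)  = refl
  plateauₛ-full (suc (suc n)) (suc a ∷ suc b ∷ e)
    with plateau (suc n) (suc b ∷ toList e) | plateauₛ-full (suc n) (suc b ∷ e)
  ... | false | _ rewrite ∧-zeroʳ (a ≡ᵇ b) = refl
  ... | true  | ()

  plateauₛ-*ₛ-factor : ∀ {n} j → j < n → (plateauₛ j *ₛ (oneₛ -ₛ mono (prefixOnes n (suc j)))) ≈ plateauₛ (suc j)
  plateauₛ-*ₛ-factor {n} j j<n e = trans (*ₛ-[one-mono] (plateauₛ j) (prefixOnes n (suc j)) e) (plateau-step j e j<n)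

  partitionsₛ-*ₛ-denominator : ∀ n → (partitionsₛ *ₛ denominator n) ≈ oneₛ
  partitionsₛ-*ₛ-denominator n e = begin
      (partitionsₛ *ₛ denominator n) e
    ≡⟨ cong (λ fs → (partitionsₛ *ₛ prodₛ fs) e) (map-upTo factor n) ⟩
      (partitionsₛ *ₛ prodₛ (applyUpTo factor n)) e
    ≡⟨ telescope n plateauₛ factor plateauₛ-*ₛ-factor e ⟩
      plateauₛ n e
    ≡⟨ plateauₛ-full n e ⟩
      oneₛ e
    ∎
    where
    open ≡-Reasoning
    factor : ℕ → FPS n
    factor j = oneₛ -ₛ mono (prefixOnes n (suc j))

module CompatibleWords where

  open import Data.Nat using (_+_; _*_; _∸_; _!)
  open import Data.Nat.Combinatorics.Base using (_P′_)
  open import Data.Nat.Combinatorics.Specification using (P′-rec; nP′n≡n!)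
  open import Data.Sum using (inj₁; inj₂)
  open import Data.Nat.DivMod using (_/_; m*n/n≡m)
  open import Relation.Binary.Definitions using (tri<; tri≈; tri>)
  open FiniteSums ℕP.+-*-isCommutativeSemiring
  open import Algebra.Properties.CommutativeSemigroup ℕP.+-commutativeSemigroup
    using () renaming (x∙yz≈y∙xz to m+[n+o]≡n+[m+o])
  open import Algebra.Properties.CommutativeSemigroup ℕP.*-commutativeSemigroup
    using () renaming (x∙yz≈y∙xz to m*[n*o]≡n*[m*o])

  descent : ℕ → ℕ → ℕ
  descent x y = [ y <ᵇ x ]

  compatible : List ℕ → List ℕ → Bool
  compatible (x ∷ y ∷ w) (a ∷ b ∷ E) = (descent x y + b ≤ᵇ a) ∧ compatible (y ∷ w) (b ∷ E)
  compatible _           _           = true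

  isBlockEnd : ℕ → List ℕ → Bool
  isBlockEnd zero    []          = false
  isBlockEnd zero    (a ∷ [])    = true
  isBlockEnd zero    (a ∷ b ∷ L) = b <ᵇ a
  isBlockEnd (suc p) []          = false
  isBlockEnd (suc p) (a ∷ L)     = isBlockEnd p L

  deleteAt : ℕ → List ℕ → List ℕ
  deleteAt p       []      = []
  deleteAt zero    (a ∷ L) = L
  deleteAt (suc p) (a ∷ L) = a ∷ deleteAt p L

  descent≤1 : ∀ x y → descent x y ≤ 1
  descent≤1 x y with y <ᵇ x
  ... | true  = ℕP.≤-refl
  ... | false = z≤n

  compatible-insertAt : ∀ m p w E → T (weaklyDecreasing E) → All (_< m) w →
    length E ≡ suc (length w) → p ≤ length w →
    compatible (insertAt p m w) E ≡ isBlockEnd p E ∧ compatible w (deleteAt p E)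
  compatible-insertAt m zero    []      (a ∷ [])     _  _           _   _ = refl
  compatible-insertAt m zero    (y ∷ w) (a ∷ b ∷ E)  _  (y<m ∷ _)   _   _ rewrite T⇒≡true (ℕP.<⇒<ᵇ y<m) = refl
  compatible-insertAt m (suc zero) (x ∷ []) (a ∷ b ∷ []) wdE (x<m ∷ _) _ _
    rewrite ¬T⇒≡false (ℕP.<⇒≯ x<m ∘ ℕP.<ᵇ⇒< m x) | T⇒≡true (T-∧ˡ {b ≤ᵇ a} wdE) = refl
  compatible-insertAt m (suc zero) (x ∷ y ∷ w) (a ∷ b ∷ c ∷ E) wdE (x<m ∷ y<m ∷ _) _ _
    rewrite ¬T⇒≡false (ℕP.<⇒≯ x<m ∘ ℕP.<ᵇ⇒< m x) | T⇒≡true (ℕP.<⇒<ᵇ y<m) | T⇒≡true (T-∧ˡ {b ≤ᵇ a} wdE)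
    with c <ᵇ b in c<ᵇb
  ... | false = refl
  -- c < b ≤ a, so deleting b keeps x and y compatible with a and c
  ... | true rewrite T⇒≡true (ℕP.≤⇒≤ᵇ {descent x y + c} {a} (ℕP.≤-trans (ℕP.+-monoˡ-≤ c (descent≤1 x y))
                       (ℕP.≤-trans (ℕP.<ᵇ⇒< c b (subst T (sym c<ᵇb) _)) (ℕP.≤ᵇ⇒≤ b a (T-∧ˡ {b ≤ᵇ a} wdE))))) = refl
  compatible-insertAt m (suc (suc p)) (x ∷ y ∷ w) (a ∷ b ∷ E) wdE (x<m ∷ w<m) |E|≡ (s≤s p≤)
    rewrite compatible-insertAt m (suc p) (y ∷ w) (b ∷ E) (T-∧ʳ {b ≤ᵇ a} wdE) w<m (ℕP.suc-injective |E|≡) p≤ =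
    ∧-swapˡ (descent x y + b ≤ᵇ a) (isBlockEnd p E) (compatible (y ∷ w) (b ∷ deleteAt p E))

  #compatible : ℕ → List ℕ → ℕ
  #compatible m E = ∑injective (length E) m (λ w → [ compatible w E ])

  length-deleteAt : ∀ p E → p < length E → length (deleteAt p E) ≡ length E ∸ 1
  length-deleteAt zero    (a ∷ E)     _         = refl
  length-deleteAt (suc p) (a ∷ b ∷ E) (s≤s p<) = cong suc (length-deleteAt p (b ∷ E) p<)

  if-[∧] : ∀ d b c → (if d then [ b ∧ c ] else 0) ≡ [ b ] * (if d then [ c ] else 0)
  if-[∧] true  true  c = sym (ℕP.+-identityʳ _)
  if-[∧] true  false c = refl
  if-[∧] false true  c = refl
  if-[∧] false false c = refl

  #compatible-suc : ∀ m E → T (weaklyDecreasing E) →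
    #compatible (suc m) E ≡ #compatible m E + ∑[ p < length E ] ([ isBlockEnd p E ] * #compatible m (deleteAt p E))
  #compatible-suc m E wdE =
    trans (∑injective-suc (length E) m (λ w → [ compatible w E ]))
          (cong (#compatible m E +_) (∑-cong< (length E) insertion))
    where
    insertion : ∀ p → p < length E →
      ∑injective (length E ∸ 1) m (λ w → [ compatible (insertAt p m w) E ])
        ≡ [ isBlockEnd p E ] * #compatible m (deleteAt p E)
    insertion p p<|E| = begin
        ∑word (length E ∸ 1) m (λ w → if distinct w then [ compatible (insertAt p m w) E ] else 0)
      ≡⟨ ∑word-cong (length E ∸ 1) m (λ w |w|≡ w<m → trans
           (cong (λ b → if distinct w then [ b ] else 0) (compatible-insertAt m p w E wdE w<m
              (trans (m<n⇒n≡1+[n∸1] p<|E|) (cong suc (sym |w|≡))) (subst (p ≤_) (sym |w|≡) (m<n⇒m≤n∸1 p<|E|))))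
           (if-[∧] (distinct w) (isBlockEnd p E) (compatible w (deleteAt p E)))) ⟩
        ∑word (length E ∸ 1) m (λ w → [ isBlockEnd p E ] * (if distinct w then [ compatible w (deleteAt p E) ] else 0))
      ≡⟨ *-distribˡ-∑word (length E ∸ 1) m [ isBlockEnd p E ] _ ⟨
        [ isBlockEnd p E ] * ∑injective (length E ∸ 1) m (λ w → [ compatible w (deleteAt p E) ])
      ≡⟨ cong (λ k → [ isBlockEnd p E ] * ∑injective k m (λ w → [ compatible w (deleteAt p E) ]))
              (length-deleteAt p E p<|E|) ⟨
        [ isBlockEnd p E ] * #compatible m (deleteAt p E)
      ∎
      where
      open ≡-Reasoning

  nth : ℕ → List ℕ → ℕ
  nth _       []      = 0
  nth zero    (a ∷ L) = a
  nth (suc p) (a ∷ L) = nth p L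

  mult-∷ : ∀ j a L → mult j (a ∷ L) ≡ [ a ≡ᵇ j ] + mult j L
  mult-∷ j a L with a ≡ᵇ j
  ... | true  = refl
  ... | false = refl

  mult-deleteAt : ∀ p L j → p < length L → mult j L ≡ [ nth p L ≡ᵇ j ] + mult j (deleteAt p L)
  mult-deleteAt zero    (a ∷ L) j _        = mult-∷ j a L
  mult-deleteAt (suc p) (a ∷ L) j (s≤s p<) = begin
      mult j (a ∷ L)
    ≡⟨ mult-∷ j a L ⟩
      [ a ≡ᵇ j ] + mult j L
    ≡⟨ cong ([ a ≡ᵇ j ] +_) (mult-deleteAt p L j p<) ⟩
      [ a ≡ᵇ j ] + ([ nth p L ≡ᵇ j ] + mult j (deleteAt p L))
    ≡⟨ m+[n+o]≡n+[m+o] [ a ≡ᵇ j ] [ nth p L ≡ᵇ j ] _ ⟩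
      [ nth p L ≡ᵇ j ] + ([ a ≡ᵇ j ] + mult j (deleteAt p L))
    ≡⟨ cong ([ nth p L ≡ᵇ j ] +_) (mult-∷ j a (deleteAt p L)) ⟨
      [ nth p L ≡ᵇ j ] + mult j (a ∷ deleteAt p L)
    ∎
    where open ≡-Reasoning

  ∏< : ℕ → (ℕ → ℕ) → ℕ
  ∏< zero    f = 1
  ∏< (suc N) f = f 0 * ∏< N (f ∘ suc)

  ∏-cong : ∀ N {f g : ℕ → ℕ} → (∀ k → f k ≡ g k) → ∏< N f ≡ ∏< N g
  ∏-cong zero    eq = refl
  ∏-cong (suc N) eq = cong₂ _*_ (eq 0) (∏-cong N (eq ∘ suc))

  ∏!-bump : ∀ N v (a b : ℕ → ℕ) → v < N → a v ≡ suc (b v) → (∀ j → j ≢ v → a j ≡ b j) →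
    ∏< N (λ j → a j !) ≡ a v * ∏< N (λ j → b j !)
  ∏!-bump (suc N) zero a b _ av≡ a≡b
    rewrite av≡ | ∏-cong N {λ j → a (suc j) !} {λ j → b (suc j) !} (λ j → cong _! (a≡b (suc j) λ ())) =
    ℕP.*-assoc (suc (b 0)) (b 0 !) _
  ∏!-bump (suc N) (suc v) a b (s≤s v<N) av≡ a≡b
    rewrite a≡b 0 (λ ()) | ∏!-bump N v (a ∘ suc) (b ∘ suc) v<N av≡ (λ j j≢v → a≡b (suc j) (j≢v ∘ ℕP.suc-injective)) =
    m*[n*o]≡n*[m*o] (b 0 !) (a (suc v)) _

  ∏mult! : ℕ → List ℕ → ℕ
  ∏mult! N E = ∏< N (λ j → mult j E !)

  nth-All : ∀ {P : ℕ → Set} p L → p < length L → All P L → P (nth p L)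
  nth-All zero    (a ∷ L) _        (pa ∷ _)  = pa
  nth-All (suc p) (a ∷ L) (s≤s p<) (_ ∷ pL) = nth-All p L p< pL

  ∏mult!-deleteAt : ∀ N p L → p < length L → All (_< N) L → ∏mult! N L ≡ mult (nth p L) L * ∏mult! N (deleteAt p L)
  ∏mult!-deleteAt N p L p< L<N = ∏!-bump N (nth p L) (λ j → mult j L) (λ j → mult j (deleteAt p L)) (nth-All p L p< L<N)
    (trans (mult-deleteAt p L (nth p L) p<) (cong (λ b → [ b ] + mult (nth p L) (deleteAt p L)) (≡ᵇ-refl (nth p L))))
    (λ j j≢ → trans (mult-deleteAt p L j p<)
                    (cong (λ b → [ b ] + mult j (deleteAt p L)) (≢⇒≡ᵇ-false (nth p L) j (j≢ ∘ sym))))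

  weaklyDecreasing-head : ∀ a L → T (weaklyDecreasing (a ∷ L)) → All (_≤ a) L
  weaklyDecreasing-head a []      _  = []
  weaklyDecreasing-head a (b ∷ L) wd =
    b≤a ∷ All.map (λ c≤b → ℕP.≤-trans c≤b b≤a) (weaklyDecreasing-head b L (T-∧ʳ {b ≤ᵇ a} wd))
    where b≤a = ℕP.≤ᵇ⇒≤ b a (T-∧ˡ {b ≤ᵇ a} wd)

  weaklyDecreasing-tail : ∀ a L → T (weaklyDecreasing (a ∷ L)) → T (weaklyDecreasing L)
  weaklyDecreasing-tail a []      _  = _
  weaklyDecreasing-tail a (b ∷ L) wd = T-∧ʳ {b ≤ᵇ a} wd

  weaklyDecreasing-∷ : ∀ a L → All (_≤ a) L → T (weaklyDecreasing L) → T (weaklyDecreasing (a ∷ L))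
  weaklyDecreasing-∷ a []      _         _  = _
  weaklyDecreasing-∷ a (b ∷ L) (b≤a ∷ _) wd rewrite T⇒≡true (ℕP.≤⇒≤ᵇ b≤a) = wd

  All-deleteAt : ∀ {P : ℕ → Set} p L → All P L → All P (deleteAt p L)
  All-deleteAt p       []      []       = []
  All-deleteAt zero    (a ∷ L) (_ ∷ pL)  = pL
  All-deleteAt (suc p) (a ∷ L) (pa ∷ pL) = pa ∷ All-deleteAt p L pL

  weaklyDecreasing-deleteAt : ∀ p L → T (weaklyDecreasing L) → T (weaklyDecreasing (deleteAt p L))
  weaklyDecreasing-deleteAt p       []      wd = wd
  weaklyDecreasing-deleteAt zero    (a ∷ L) wd = weaklyDecreasing-tail a L wd
  weaklyDecreasing-deleteAt (suc p) (a ∷ L) wd =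
    weaklyDecreasing-∷ a (deleteAt p L) (All-deleteAt p L (weaklyDecreasing-head a L wd))
                       (weaklyDecreasing-deleteAt p L (weaklyDecreasing-tail a L wd))

  startsWith : ℕ → List ℕ → Bool
  startsWith a []      = false
  startsWith a (b ∷ _) = a ≡ᵇ b

  ∑-isBlockEnd-≡ᵇ : ∀ a L → T (weaklyDecreasing L) → All (_≤ a) L →
    ∑[ p < length L ] ([ isBlockEnd p L ] * [ a ≡ᵇ nth p L ]) ≡ [ startsWith a L ]
  ∑-isBlockEnd-≡ᵇ a []      _  _           = refl
  ∑-isBlockEnd-≡ᵇ a (b ∷ L) wd (b≤a ∷ L≤a)
    rewrite ∑-isBlockEnd-≡ᵇ a L (weaklyDecreasing-tail b L wd)
                               (All.map (λ c≤b → ℕP.≤-trans c≤b b≤a) (weaklyDecreasing-head b L wd))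
    with ℕP.<-cmp b a
  ... | tri> _ _ a<b = ⊥-elim (ℕP.<⇒≱ a<b b≤a)
  ... | tri< b<a _ _ rewrite ≢⇒≡ᵇ-false a b (ℕP.>⇒≢ b<a) =
    trans (cong (_+ [ startsWith a L ]) (ℕP.*-zeroʳ [ isBlockEnd 0 (b ∷ L) ]))
          (notStart L (weaklyDecreasing-head b L wd))
    where
    notStart : ∀ L → All (_≤ b) L → [ startsWith a L ] ≡ 0
    notStart []      _         = refl
    notStart (c ∷ L) (c≤b ∷ _) rewrite ≢⇒≡ᵇ-false a c (ℕP.>⇒≢ (ℕP.≤-<-trans c≤b b<a)) = refl
  ... | tri≈ _ refl _ rewrite ≡ᵇ-refl b with L | weaklyDecreasing-head b L wd
  ... | []     | _         = refl
  ... | c ∷ L′ | c≤b ∷ _ with ℕP.<-cmp c b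
  ... | tri< c<b _ _ rewrite T⇒≡true (ℕP.<⇒<ᵇ c<b) | ≢⇒≡ᵇ-false b c (ℕP.>⇒≢ c<b) = refl
  ... | tri≈ _ refl _ rewrite ≡ᵇ-refl c | ¬T⇒≡false (ℕP.<-irrefl refl ∘ ℕP.<ᵇ⇒< c c) = refl
  ... | tri> _ _ b<c = ⊥-elim (ℕP.<⇒≱ b<c c≤b)

  -- Each block of E ends exactly once, and the multiplicity of its value is its length.
  ∑-isBlockEnd-mult : ∀ E → T (weaklyDecreasing E) →
    ∑[ p < length E ] ([ isBlockEnd p E ] * mult (nth p E) E) ≡ length E
  ∑-isBlockEnd-mult []      _  = refl
  ∑-isBlockEnd-mult (a ∷ L) wd = begin
      [ isBlockEnd 0 (a ∷ L) ] * mult a (a ∷ L) + ∑[ p < length L ] ([ isBlockEnd p L ] * mult (nth p L) (a ∷ L))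
    ≡⟨ cong₂ (λ x y → [ isBlockEnd 0 (a ∷ L) ] * x + y)
         (trans (mult-∷ a a L) (cong (λ b → [ b ] + mult a L) (≡ᵇ-refl a)))
         (∑-cong (length L) (λ p → trans (cong ([ isBlockEnd p L ] *_) (mult-∷ (nth p L) a L))
                                         (ℕP.*-distribˡ-+ [ isBlockEnd p L ] _ _))) ⟩
      [ isBlockEnd 0 (a ∷ L) ] * suc (mult a L)
        + ∑[ p < length L ] ([ isBlockEnd p L ] * [ a ≡ᵇ nth p L ] + [ isBlockEnd p L ] * mult (nth p L) L)
    ≡⟨ cong ([ isBlockEnd 0 (a ∷ L) ] * suc (mult a L) +_) (∑-distrib-+ (length L) _ _) ⟩
      [ isBlockEnd 0 (a ∷ L) ] * suc (mult a L)
        + (∑[ p < length L ] ([ isBlockEnd p L ] * [ a ≡ᵇ nth p L ])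
           + ∑[ p < length L ] ([ isBlockEnd p L ] * mult (nth p L) L))
    ≡⟨ cong₂ (λ x y → [ isBlockEnd 0 (a ∷ L) ] * suc (mult a L) + (x + y))
         (∑-isBlockEnd-≡ᵇ a L (weaklyDecreasing-tail a L wd) (weaklyDecreasing-head a L wd))
         (∑-isBlockEnd-mult L (weaklyDecreasing-tail a L wd)) ⟩
      [ isBlockEnd 0 (a ∷ L) ] * suc (mult a L) + ([ startsWith a L ] + length L)
    ≡⟨ firstBlock L wd ⟩
      suc (length L)
    ∎
    where
    open ≡-Reasoning
    firstBlock : ∀ L → T (weaklyDecreasing (a ∷ L)) →
      [ isBlockEnd 0 (a ∷ L) ] * suc (mult a L) + ([ startsWith a L ] + length L) ≡ suc (length L)
    firstBlock []      _   = refl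
    firstBlock (b ∷ L) wd′ with weaklyDecreasing-head a (b ∷ L) wd′
    ... | b≤a ∷ _ with ℕP.<-cmp b a
    ... | tri< b<a _ _
      rewrite T⇒≡true (ℕP.<⇒<ᵇ b<a) | ≢⇒≡ᵇ-false a b (ℕP.>⇒≢ b<a)
            | mult-absent {a} (b ∷ L)
                (b<a ∷ All.map (λ c≤b → ℕP.≤-<-trans c≤b b<a)
                               (weaklyDecreasing-head b L (weaklyDecreasing-tail a (b ∷ L) wd′))) = refl
    ... | tri≈ _ refl _ rewrite ¬T⇒≡false (ℕP.<-irrefl refl ∘ ℕP.<ᵇ⇒< b b) | ≡ᵇ-refl b = refl
    ... | tri> _ _ a<b = ⊥-elim (ℕP.<⇒≱ a<b b≤a)

  m<k⇒mP′k≡0 : ∀ {m k} → m < k → m P′ k ≡ 0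
  m<k⇒mP′k≡0 {m} {suc k} (s≤s m≤k) rewrite ℕP.m≤n⇒m∸n≡0 m≤k = refl

  P′-suc : ∀ m k → suc m P′ k ≡ m P′ k + k * (m P′ (k ∸ 1))
  P′-suc m zero    = refl
  P′-suc m (suc k) with ℕP.≤-<-connex k m
  ... | inj₁ k≤m = trans (P′-rec (s≤s k≤m)) (ℕP.+-comm _ (m P′ suc k))
  ... | inj₂ m<k rewrite m<k⇒mP′k≡0 (s≤s m<k) | m<k⇒mP′k≡0 {m} {suc k} (ℕP.m<n⇒m<1+n m<k) | m<k⇒mP′k≡0 m<k
    = sym (ℕP.*-zeroʳ (suc k))

  ∏-one : ∀ N → ∏< N (λ _ → 1) ≡ 1
  ∏-one zero    = refl
  ∏-one (suc N) = trans (ℕP.+-identityʳ _) (∏-one N)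

  -- Induction on m: the new letter m goes to a block end p, and the weight ∏ mⱼ! turns the
  -- sum over block ends into |E|.
  #compatible-*-∏mult! : ∀ m N E → T (weaklyDecreasing E) → All (_< N) E → #compatible m E * ∏mult! N E ≡ m P′ length E
  #compatible-*-∏mult! zero    N []      _  _   = trans (ℕP.+-identityʳ _) (∏-one N)
  #compatible-*-∏mult! zero    N (a ∷ E) _  _   = sym (cong (_* (0 P′ length E)) (ℕP.0∸n≡0 (length E)))
  #compatible-*-∏mult! (suc m) N E       wd E<N = begin
      #compatible (suc m) E * ∏mult! N E
    ≡⟨ cong (_* ∏mult! N E) (#compatible-suc m E wd) ⟩
      (#compatible m E + ∑[ p < k ] ([ isBlockEnd p E ] * #compatible m (deleteAt p E))) * ∏mult! N E
    ≡⟨ ℕP.*-distribʳ-+ (∏mult! N E) (#compatible m E) _ ⟩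
      #compatible m E * ∏mult! N E + ∑[ p < k ] ([ isBlockEnd p E ] * #compatible m (deleteAt p E)) * ∏mult! N E
    ≡⟨ cong₂ _+_ (#compatible-*-∏mult! m N E wd E<N) (*-distribʳ-∑ k (∏mult! N E) _) ⟩
      m P′ k + ∑[ p < k ] ([ isBlockEnd p E ] * #compatible m (deleteAt p E) * ∏mult! N E)
    ≡⟨ cong (m P′ k +_) (∑-cong< k deletion) ⟩
      m P′ k + ∑[ p < k ] ([ isBlockEnd p E ] * mult (nth p E) E * (m P′ (k ∸ 1)))
    ≡⟨ cong (m P′ k +_) (trans (sym (*-distribʳ-∑ k (m P′ (k ∸ 1)) _))
                              (cong (_* (m P′ (k ∸ 1))) (∑-isBlockEnd-mult E wd))) ⟩
      m P′ k + k * (m P′ (k ∸ 1))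
    ≡⟨ P′-suc m k ⟨
      suc m P′ k
    ∎
    where
    open ≡-Reasoning
    k = length E
    deletion : ∀ p → p < k →
      [ isBlockEnd p E ] * #compatible m (deleteAt p E) * ∏mult! N E
        ≡ [ isBlockEnd p E ] * mult (nth p E) E * (m P′ (k ∸ 1))
    deletion p p<k = begin
        [ isBlockEnd p E ] * #compatible m (deleteAt p E) * ∏mult! N E
      ≡⟨ cong ([ isBlockEnd p E ] * #compatible m (deleteAt p E) *_) (∏mult!-deleteAt N p E p<k E<N) ⟩
        [ isBlockEnd p E ] * #compatible m (deleteAt p E) * (mult (nth p E) E * ∏mult! N (deleteAt p E))
      ≡⟨ ℕP.[m*n]*[o*p]≡[m*o]*[n*p] [ isBlockEnd p E ] _ _ _ ⟩
        [ isBlockEnd p E ] * mult (nth p E) E * (#compatible m (deleteAt p E) * ∏mult! N (deleteAt p E))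
      ≡⟨ cong ([ isBlockEnd p E ] * mult (nth p E) E *_) (trans
           (#compatible-*-∏mult! m N (deleteAt p E) (weaklyDecreasing-deleteAt p E wd) (All-deleteAt p E E<N))
           (cong (m P′_) (length-deleteAt p E p<k))) ⟩
        [ isBlockEnd p E ] * mult (nth p E) E * (m P′ (k ∸ 1))
      ∎

  ∑-mult : ∀ N E → All (_< N) E → ∑[ j < N ] mult j E ≡ length E
  ∑-mult N []      []          = ∑-zero N
  ∑-mult N (a ∷ E) (a<N ∷ E<N) = begin
      ∑[ j < N ] mult j (a ∷ E)
    ≡⟨ ∑-cong N (λ j → mult-∷ j a E) ⟩
      ∑[ j < N ] ([ a ≡ᵇ j ] + mult j E)
    ≡⟨ ∑-distrib-+ N _ _ ⟩
      ∑[ j < N ] [ a ≡ᵇ j ] + ∑[ j < N ] mult j E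
    ≡⟨ cong₂ _+_ (trans (∑-δ N a (λ _ → 1)) (cong (λ b → if b then 1 else 0) (T⇒≡true (ℕP.<⇒<ᵇ a<N))))
                 (∑-mult N E E<N) ⟩
      suc (length E)
    ∎
    where open ≡-Reasoning

  prodFact-applyUpTo : ∀ (f g : ℕ → ℕ) N → prodFact (List.map f (applyUpTo g N)) ≡ ∏< N (λ j → f (g j) !)
  prodFact-applyUpTo f g zero    = refl
  prodFact-applyUpTo f g (suc N) = cong (f (g 0) ! *_) (prodFact-applyUpTo f (g ∘ suc) N)

  All≤sum : ∀ E → All (_≤ sumₗ E) E
  All≤sum []      = []
  All≤sum (a ∷ E) = ℕP.m≤m+n a (sumₗ E) ∷ All.map (λ x≤ → ℕP.≤-trans x≤ (ℕP.m≤n+m (sumₗ E) a)) (All≤sum E)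

  multinomial-multiplicities : ∀ E → T (weaklyDecreasing E) → multinomial (multiplicities E) ≡ #compatible (length E) E
  multinomial-multiplicities E wd = begin
      ((sumₗ ms) ! / prodFact ms) {{prodFact≢0 ms}}
    ≡⟨ cong (λ x → (x ! / prodFact ms) {{prodFact≢0 ms}}) (trans (sum-upTo (λ j → mult j E) N) (∑-mult N E E<N)) ⟩
      ((length E) ! / prodFact ms) {{prodFact≢0 ms}}
    ≡⟨ cong (λ x → (x / prodFact ms) {{prodFact≢0 ms}}) counted ⟨
      ((#compatible (length E) E * prodFact ms) / prodFact ms) {{prodFact≢0 ms}}
    ≡⟨ m*n/n≡m (#compatible (length E) E) (prodFact ms) {{prodFact≢0 ms}} ⟩
      #compatible (length E) E
    ∎
    where
    open ≡-Reasoning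
    N  = suc (sumₗ E)
    ms = multiplicities E
    E<N : All (_< N) E
    E<N = All.map s≤s (All≤sum E)
    counted : #compatible (length E) E * prodFact ms ≡ (length E) !
    counted = begin
        #compatible (length E) E * prodFact ms
      ≡⟨ cong (#compatible (length E) E *_) (prodFact-applyUpTo (λ j → mult j E) id N) ⟩
        #compatible (length E) E * ∏mult! N E
      ≡⟨ #compatible-*-∏mult! (length E) N E wd E<N ⟩
        length E P′ length E
      ≡⟨ nP′n≡n! (length E) ⟩
        (length E) !
      ∎

  compatible⇒weaklyDecreasing : ∀ w E → length w ≡ length E → T (compatible w E) → T (weaklyDecreasing E)
  compatible⇒weaklyDecreasing []          []          _     _ = _
  compatible⇒weaklyDecreasing (x ∷ [])    (a ∷ [])    _     _ = _
  compatible⇒weaklyDecreasing (x ∷ y ∷ w) (a ∷ b ∷ E) |w|≡ c =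
    Equivalence.from T-∧ (ℕP.≤⇒≤ᵇ (ℕP.m+n≤o⇒n≤o (descent x y) (ℕP.≤ᵇ⇒≤ _ a (T-∧ˡ {descent x y + b ≤ᵇ a} c))) ,
                          compatible⇒weaklyDecreasing (y ∷ w) (b ∷ E) (ℕP.suc-injective |w|≡)
                                                      (T-∧ʳ {descent x y + b ≤ᵇ a} c))

  #compatible-length : ∀ E →
    #compatible (length E) E ≡ (if weaklyDecreasing E then multinomial (multiplicities E) else 0)
  #compatible-length E with weaklyDecreasing E in wdE
  ... | true  = sym (multinomial-multiplicities E (subst T (sym wdE) _))
  ... | false = trans (∑word-cong (length E) (length E) noCompatible) (∑word-zero (length E) (length E))
    where
    noCompatible : ∀ w → length w ≡ length E → All (_< length E) w →
      (if distinct w then [ compatible w E ] else 0) ≡ 0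
    noCompatible w |w|≡ _
      rewrite ¬T⇒≡false (λ c → subst T wdE (compatible⇒weaklyDecreasing w E |w|≡ c)) with distinct w
    ... | true  = refl
    ... | false = refl

module DescentVectors where

  open import Data.Nat using (_+_; _∸_)
  open FiniteSums ℕP.+-*-isCommutativeSemiring
  open CompatibleWords

  descentVector : List ℕ → List ℕ
  descentVector w = suffixSums (descentInd w ++ 0 ∷ [])

  d₁ : List ℕ → ℕ
  d₁ w = sumₗ (descentInd w ++ 0 ∷ [])

  applyUpTo-entries : ∀ D → applyUpTo (λ i → sumₗ (List.take 1 (List.drop i D))) (suc (length D)) ≡ D ++ 0 ∷ []
  applyUpTo-entries []      = refl
  applyUpTo-entries (d ∷ D) = cong₂ _∷_ (ℕP.+-identityʳ d) (applyUpTo-entries D)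

  length-descentInd : ∀ x w → length (descentInd (x ∷ w)) ≡ length w
  length-descentInd x []      = refl
  length-descentInd x (y ∷ w) = cong suc (length-descentInd y w)

  dvec≡descentVector : ∀ x w → dvec (x ∷ w) ≡ descentVector (x ∷ w)
  dvec≡descentVector x w = cong suffixSums (begin
      List.map entry (upTo (suc (length w)))
    ≡⟨ map-upTo entry (suc (length w)) ⟩
      applyUpTo entry (suc (length w))
    ≡⟨ cong (λ k → applyUpTo entry (suc k)) (length-descentInd x w) ⟨
      applyUpTo entry (suc (length (descentInd (x ∷ w))))
    ≡⟨ applyUpTo-entries (descentInd (x ∷ w)) ⟩
      descentInd (x ∷ w) ++ 0 ∷ []
    ∎)
    where
    open ≡-Reasoning
    entry : ℕ → ℕ
    entry i = sumₗ (List.take 1 (List.drop i (descentInd (x ∷ w))))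

  -- fits L E: L ≤ E entrywise and E ∸ L is weakly decreasing; fitsBelow t also bounds its first entry by t
  fitsBelow : ℕ → List ℕ → List ℕ → Bool
  fitsBelow t []      []      = true
  fitsBelow t (y ∷ L) (x ∷ E) = (y ≤ᵇ x) ∧ ((x ∸ y ≤ᵇ t) ∧ fitsBelow (x ∸ y) L E)
  fitsBelow t _       _       = false

  fits : List ℕ → List ℕ → Bool
  fits []      []      = true
  fits (y ∷ L) (x ∷ E) = (y ≤ᵇ x) ∧ fitsBelow (x ∸ y) L E
  fits _       _       = false

  [m∸n]+[o+n]≡o+m : ∀ {m n} o → n ≤ m → (m ∸ n) + (o + n) ≡ o + m
  [m∸n]+[o+n]≡o+m {m} {n} o n≤m = begin
      (m ∸ n) + (o + n)  ≡⟨ ℕP.+-comm (m ∸ n) (o + n) ⟩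
      o + n + (m ∸ n)    ≡⟨ ℕP.+-assoc o n (m ∸ n) ⟩
      o + (n + (m ∸ n))  ≡⟨ cong (o +_) (ℕP.m+[n∸m]≡n n≤m) ⟩
      o + m              ∎
    where open ≡-Reasoning

  lowering-ordered : ∀ δ h a b → h ≤ b → (δ + h ≤ᵇ a) ∧ (b ∸ h ≤ᵇ a ∸ (δ + h)) ≡ (δ + b ≤ᵇ a)
  lowering-ordered δ h a b h≤b = T-ext to from
    where
    to : T ((δ + h ≤ᵇ a) ∧ (b ∸ h ≤ᵇ a ∸ (δ + h))) → T (δ + b ≤ᵇ a)
    to t = ℕP.≤⇒≤ᵇ (subst (_≤ a) ([m∸n]+[o+n]≡o+m δ h≤b)
             (ℕP.m≤o∸n⇒m+n≤o (b ∸ h) (ℕP.≤ᵇ⇒≤ _ a (T-∧ˡ {δ + h ≤ᵇ a} t)) (ℕP.≤ᵇ⇒≤ _ _ (T-∧ʳ {δ + h ≤ᵇ a} t))))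
    from : T (δ + b ≤ᵇ a) → T ((δ + h ≤ᵇ a) ∧ (b ∸ h ≤ᵇ a ∸ (δ + h)))
    from t = Equivalence.from T-∧ (ℕP.≤⇒≤ᵇ (ℕP.≤-trans (ℕP.+-monoʳ-≤ δ h≤b) δ+b≤a) ,
               ℕP.≤⇒≤ᵇ (ℕP.m+n≤o⇒m≤o∸n (b ∸ h) (subst (_≤ a) (sym ([m∸n]+[o+n]≡o+m δ h≤b)) δ+b≤a)))
      where δ+b≤a = ℕP.≤ᵇ⇒≤ (δ + b) a t

  lowering-compatible : ∀ δ h a b C → (T C → h ≤ b) →
    (δ + h ≤ᵇ a) ∧ ((b ∸ h ≤ᵇ a ∸ (δ + h)) ∧ C) ≡ (δ + b ≤ᵇ a) ∧ C
  lowering-compatible δ h a b false _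
    rewrite ∧-zeroʳ (b ∸ h ≤ᵇ a ∸ (δ + h)) | ∧-zeroʳ (δ + h ≤ᵇ a) | ∧-zeroʳ (δ + b ≤ᵇ a) = refl
  lowering-compatible δ h a b true  C⇒h≤b
    rewrite ∧-identityʳ (b ∸ h ≤ᵇ a ∸ (δ + h)) | ∧-identityʳ (δ + b ≤ᵇ a) = lowering-ordered δ h a b (C⇒h≤b _)

  d₁-≤-head : ∀ x w a E → length w ≡ length E → T (compatible (x ∷ w) (a ∷ E)) → d₁ (x ∷ w) ≤ a
  d₁-≤-head x []      a []      _    _ = z≤n
  d₁-≤-head x (y ∷ w) a (b ∷ E) |w|≡ c = ℕP.≤-trans
    (ℕP.+-monoʳ-≤ (descent x y) (d₁-≤-head y w b E (ℕP.suc-injective |w|≡) (T-∧ʳ {descent x y + b ≤ᵇ a} c)))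
    (ℕP.≤ᵇ⇒≤ _ a (T-∧ˡ {descent x y + b ≤ᵇ a} c))

  fitsBelow-descentVector : ∀ t x w a E → length w ≡ length E →
    fitsBelow t (descentVector (x ∷ w)) (a ∷ E) ≡ (a ∸ d₁ (x ∷ w) ≤ᵇ t) ∧ compatible (x ∷ w) (a ∷ E)
  fitsBelow-descentVector t x []      a []      _ = refl
  fitsBelow-descentVector t x (y ∷ w) a (b ∷ E) |w|≡
    rewrite fitsBelow-descentVector (a ∸ (descent x y + d₁ (y ∷ w))) y w b E (ℕP.suc-injective |w|≡) = begin
      (δ + h ≤ᵇ a) ∧ ((a ∸ (δ + h) ≤ᵇ t) ∧ ((b ∸ h ≤ᵇ a ∸ (δ + h)) ∧ C))
    ≡⟨ ∧-swapˡ (δ + h ≤ᵇ a) (a ∸ (δ + h) ≤ᵇ t) _ ⟩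
      (a ∸ (δ + h) ≤ᵇ t) ∧ ((δ + h ≤ᵇ a) ∧ ((b ∸ h ≤ᵇ a ∸ (δ + h)) ∧ C))
    ≡⟨ cong ((a ∸ (δ + h) ≤ᵇ t) ∧_) (lowering-compatible δ h a b C (d₁-≤-head y w b E (ℕP.suc-injective |w|≡))) ⟩
      (a ∸ (δ + h) ≤ᵇ t) ∧ ((δ + b ≤ᵇ a) ∧ C)
    ∎
    where
    open ≡-Reasoning
    δ = descent x y
    h = d₁ (y ∷ w)
    C = compatible (y ∷ w) (b ∷ E)

  fits-descentVector : ∀ x w a E → length w ≡ length E →
    fits (descentVector (x ∷ w)) (a ∷ E) ≡ compatible (x ∷ w) (a ∷ E)
  fits-descentVector x []      a []      _ = refl
  fits-descentVector x (y ∷ w) a (b ∷ E) |w|≡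
    rewrite fitsBelow-descentVector (a ∸ (descent x y + d₁ (y ∷ w))) y w b E (ℕP.suc-injective |w|≡) =
    lowering-compatible (descent x y) (d₁ (y ∷ w)) a b _ (d₁-≤-head y w b E (ℕP.suc-injective |w|≡))

  fits-dvec : ∀ w E → length w ≡ length E → fits (dvec w) E ≡ compatible w E
  fits-dvec []      []      _    = refl
  fits-dvec (x ∷ w) (a ∷ E) |w|≡ =
    trans (cong (λ d → fits d (a ∷ E)) (dvec≡descentVector x w)) (fits-descentVector x w a E (ℕP.suc-injective |w|≡))

  does-≟-true : ∀ b → does (b Bool.≟ true) ≡ b
  does-≟-true true  = refl
  does-≟-true false = refl

  sum-perms-fits : ∀ n E → length E ≡ n → sumₗ (List.map (λ w → [ fits (dvec w) E ]) (perms n)) ≡ #compatible n E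
  sum-perms-fits n E refl = begin
      sumₗ (List.map g (filter (λ w → distinct w Bool.≟ true) (words n n)))
    ≡⟨ sum-filter (λ w → distinct w Bool.≟ true) g (words n n) ⟩
      sumₗ (List.map (λ w → if does (distinct w Bool.≟ true) then g w else 0) (words n n))
    ≡⟨ sum-map-cong (λ w → cong (λ b → if b then g w else 0) (does-≟-true (distinct w))) (words n n) ⟩
      sumₗ (List.map (λ w → if distinct w then g w else 0) (words n n))
    ≡⟨ sum-words n n _ ⟩
      ∑injective n n g
    ≡⟨ ∑word-cong n n (λ w |w|≡n _ → cong (λ b → if distinct w then [ b ] else 0) (fits-dvec w E |w|≡n)) ⟩
      #compatible n E
    ∎
    where
    open ≡-Reasoning
    g : List ℕ → ℕ
    g w = [ fits (dvec w) E ]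

module NumeratorSeries where

  open import Data.Integer as ℤ using (ℤ; +_; _*_)
  import Data.Integer.Properties as ℤP
  import Data.List.Properties as LP
  open import Data.Vec using (toList)
  import Data.Vec.Properties as VP
  open PowerSeriesAlgebra
  open PartitionSeries using (partitionsₛ)
  open CompatibleWords using (#compatible; #compatible-length)
  open DescentVectors using (fits; fitsBelow; sum-perms-fits)
  module ℕΣ = FiniteSums ℕP.+-*-isCommutativeSemiring

  -- shifted L K is the series q^L ⋅ K
  shifted : ∀ {n} → List ℕ → FPS n → FPS n
  shifted []      K []      = K []
  shifted (y ∷ L) K (x ∷ e) = if y ≤ᵇ x then shifted L (λ v → K ((x ℕ.∸ y) ∷ v)) e else + 0
  shifted []      K (x ∷ e) = + 0
  shifted (y ∷ L) K []      = + 0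

  [∧]-* : ∀ b c (x : ℤ) → [ b ∧ c ] * x ≡ (if b then [ c ] * x else + 0)
  [∧]-* true  c x = refl
  [∧]-* false c x = refl

  ∑≤-listMonomial : ∀ {n} L (e : Vec ℕ n) (K : FPS n) →
    ∑[ a ≤ e ] ([ does (LP.≡-dec ℕ._≟_ L (toList a)) ] * K (e ∸ᵥ a)) ≡ shifted L K e
  ∑≤-listMonomial []      []      K = ℤP.*-identityˡ (K [])
  ∑≤-listMonomial (y ∷ L) []      K = refl
  ∑≤-listMonomial []      (x ∷ e) K = trans (∑-cong (suc x) (λ k → ∑≤-zero e)) (∑-zero (suc x))
  ∑≤-listMonomial (y ∷ L) (x ∷ e) K = begin
      ∑[ k < suc x ] ∑[ a ≤ e ] ([ (y ≡ᵇ k) ∧ does (LP.≡-dec ℕ._≟_ L (toList a)) ] * K ((x ℕ.∸ k) ∷ (e ∸ᵥ a)))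
    ≡⟨ ∑-cong (suc x) (λ k → trans (∑≤-cong e (λ a → [∧]-* (y ≡ᵇ k) (does (LP.≡-dec ℕ._≟_ L (toList a))) _))
                                   (∑≤-if e (y ≡ᵇ k) (term k))) ⟩
      ∑[ k < suc x ] (if y ≡ᵇ k then ∑≤ e (term k) else + 0)
    ≡⟨ ∑-cong (suc x) (λ k → cong (λ z → if y ≡ᵇ k then z else + 0)
                                  (∑≤-listMonomial L e (λ v → K ((x ℕ.∸ k) ∷ v)))) ⟩
      ∑[ k < suc x ] (if y ≡ᵇ k then shifted L (λ v → K ((x ℕ.∸ k) ∷ v)) e else + 0)
    ≡⟨ ∑-δ (suc x) y (λ k → shifted L (λ v → K ((x ℕ.∸ k) ∷ v)) e) ⟩
      (if y <ᵇ suc x then shifted L (λ v → K ((x ℕ.∸ y) ∷ v)) e else + 0)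
    ≡⟨ cong (λ b → if b then shifted L (λ v → K ((x ℕ.∸ y) ∷ v)) e else + 0) (<ᵇ-suc y x) ⟩
      shifted (y ∷ L) K (x ∷ e)
    ∎
    where
    open ≡-Reasoning
    term : ℕ → Vec ℕ _ → ℤ
    term k a = [ does (LP.≡-dec ℕ._≟_ L (toList a)) ] * K ((x ℕ.∸ k) ∷ (e ∸ᵥ a))

  shifted-zero : ∀ {n} L (e : Vec ℕ n) → shifted L (λ _ → + 0) e ≡ + 0
  shifted-zero []      []      = refl
  shifted-zero (y ∷ L) []      = refl
  shifted-zero []      (x ∷ e) = refl
  shifted-zero (y ∷ L) (x ∷ e) with y ≤ᵇ x
  ... | true  = shifted-zero L e
  ... | false = refl

  shifted-partitionsBelow : ∀ {n} t L (e : Vec ℕ n) →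
    shifted L (λ v → [ weaklyDecreasing (t ∷ toList v) ]) e ≡ [ fitsBelow t L (toList e) ]
  shifted-partitionsBelow t []      []      = refl
  shifted-partitionsBelow t (y ∷ L) []      = refl
  shifted-partitionsBelow t []      (x ∷ e) = refl
  shifted-partitionsBelow t (y ∷ L) (x ∷ e) with y ≤ᵇ x | x ℕ.∸ y ≤ᵇ t
  ... | false | _     = refl
  ... | true  | true  = shifted-partitionsBelow (x ℕ.∸ y) L e
  ... | true  | false = shifted-zero L e

  shifted-partitions : ∀ {n} L (e : Vec ℕ n) → shifted L partitionsₛ e ≡ [ fits L (toList e) ]
  shifted-partitions []      []      = refl
  shifted-partitions (y ∷ L) []      = refl
  shifted-partitions []      (x ∷ e) = refl
  shifted-partitions (y ∷ L) (x ∷ e) with y ≤ᵇ x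
  ... | true  = shifted-partitionsBelow (x ℕ.∸ y) L e
  ... | false = refl

  +-length-filter : ∀ {B : Set} {P : B → Set} (P? : Decidable P) xs →
    + length (filter P? xs) ≡ sumₗ (List.map (λ x → [ does (P? x) ]) xs)
  +-length-filter P? []       = refl
  +-length-filter P? (x ∷ xs) with does (P? x)
  ... | true  = cong (ℤ._+_ (+ 1)) (+-length-filter P? xs)
  ... | false = trans (+-length-filter P? xs) (sym (ℤP.+-identityˡ _))

  +-sum : ∀ {B : Set} (g : B → ℕ) xs → sumₗ (List.map (λ x → + g x) xs) ≡ + ℕΣ.sumₗ (List.map g xs)
  +-sum g []       = refl
  +-sum g (x ∷ xs) = trans (cong (ℤ._+_ (+ g x)) (+-sum g xs)) (sym (ℤP.pos-+ (g x) _))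

  [b]≡+[b] : ∀ b → [ b ] ≡ + ℕΣ.[ b ]
  [b]≡+[b] true  = refl
  [b]≡+[b] false = refl

  numerator-*ₛ-partitions : ∀ n (e : Vec ℕ n) → (numerator n *ₛ partitionsₛ) e ≡ + #compatible n (toList e)
  numerator-*ₛ-partitions n e = begin
      (numerator n *ₛ partitionsₛ) e
    ≡⟨ coeff-*ₛ (numerator n) partitionsₛ e ⟩
      ∑[ a ≤ e ] (numerator n a * partitionsₛ (e ∸ᵥ a))
    ≡⟨ ∑≤-cong e (λ a → trans (cong (_* partitionsₛ (e ∸ᵥ a)) (+-length-filter (dvec≟ a) (perms n)))
                              (*-distribʳ-sum (partitionsₛ (e ∸ᵥ a)) _ (perms n))) ⟩
      ∑[ a ≤ e ] sumₗ (List.map (λ w → [ does (dvec≟ a w) ] * partitionsₛ (e ∸ᵥ a)) (perms n))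
    ≡⟨ sum-∑≤-comm e (λ w a → [ does (dvec≟ a w) ] * partitionsₛ (e ∸ᵥ a)) (perms n) ⟩
      sumₗ (List.map (λ w → ∑[ a ≤ e ] ([ does (dvec≟ a w) ] * partitionsₛ (e ∸ᵥ a))) (perms n))
    ≡⟨ sum-map-cong (λ w → trans (∑≤-listMonomial (dvec w) e partitionsₛ) (shifted-partitions (dvec w) e))
                    (perms n) ⟩
      sumₗ (List.map (λ w → [ fits (dvec w) (toList e) ]) (perms n))
    ≡⟨ trans (sum-map-cong (λ w → [b]≡+[b] (fits (dvec w) (toList e))) (perms n)) (+-sum _ (perms n)) ⟩
      + ℕΣ.sumₗ (List.map (λ w → ℕΣ.[ fits (dvec w) (toList e) ]) (perms n))
    ≡⟨ cong +_ (sum-perms-fits n (toList e) (VP.length-toList e)) ⟩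
      + #compatible n (toList e)
    ∎
    where
    open ≡-Reasoning
    dvec≟ : (a : Vec ℕ n) → Decidable (λ w → dvec w ≡ toList a)
    dvec≟ a w = LP.≡-dec ℕ._≟_ (dvec w) (toList a)

  +-if : ∀ b (x : ℕ) → + (if b then x else 0) ≡ (if b then + x else + 0)
  +-if true  x = refl
  +-if false x = refl

  numerator-*ₛ-partitions≈lhs : ∀ n → (numerator n *ₛ partitionsₛ) ≈ lhs n
  numerator-*ₛ-partitions≈lhs n e = begin
      (numerator n *ₛ partitionsₛ) e
    ≡⟨ numerator-*ₛ-partitions n e ⟩
      + #compatible n (toList e)
    ≡⟨ cong (λ k → + #compatible k (toList e)) (VP.length-toList e) ⟨
      + #compatible (length (toList e)) (toList e)
    ≡⟨ trans (cong +_ (#compatible-length (toList e))) (+-if _ _) ⟩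
      lhs n e
    ∎
    where open ≡-Reasoning

open PowerSeriesAlgebra using (*ₛ-congˡ; *ₛ-congʳ; *ₛ-assoc; *ₛ-identityʳ)
open PartitionSeries using (partitionsₛ; partitionsₛ-*ₛ-denominator)
open NumeratorSeries using (numerator-*ₛ-partitions≈lhs)

-- The identity also holds for n = 0.
theorem6p2 : (n : ℕ) → 1 ≤ n → (lhs n *ₛ denominator n) ≈ numerator n
theorem6p2 n _ e = begin
    (lhs n *ₛ denominator n) e
  ≡⟨ *ₛ-congˡ (denominator n) (λ v → sym (numerator-*ₛ-partitions≈lhs n v)) e ⟩
    ((numerator n *ₛ partitionsₛ) *ₛ denominator n) e
  ≡⟨ *ₛ-assoc (numerator n) partitionsₛ (denominator n) e ⟩
    (numerator n *ₛ (partitionsₛ *ₛ denominator n)) e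
  ≡⟨ *ₛ-congʳ (numerator n) (partitionsₛ-*ₛ-denominator n) e ⟩
    (numerator n *ₛ oneₛ) e
  ≡⟨ *ₛ-identityʳ (numerator n) e ⟩
    numerator n e
  ∎
  where open ≡-Reasoning
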